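{- Let $(s,h)$ be a model and let $A_1,A_2$ be abstract memory states with $\mathrm{abst}(s,h)=A_1\odot A_2$. Then there exist heaps $h_1,h_2$ with $h=h_1\uplus^s h_2$, $\mathrm{abst}(s,h_1)=A_1$ and $\mathrm{abst}(s,h_2)=A_2$.
   Context: $\mathrm{Loc}$ is an infinite set of locations, $\mathrm{Var}$ an infinite set of variables containing $\mathsf{nil}$. A stack is a partial function $s:\mathrm{Var}\rightharpoonup\mathrm{Loc}$; a heap is a finite partial function $h:\mathrm{Loc}\rightharpoonup\mathrm{Loc}$; a model is $(s,h)$ with $\mathsf{nil}\in\mathrm{dom}(s)$, $s(\mathsf{nil})\notin\mathrm{dom}(h)$. $\mathrm{locs}(h)=\mathrm{dom}(h)\cup\mathrm{img}(h)$; $h_1\uplus^s h_2:=h_1\cup h_2$ if $\mathrm{dom}(h_1)\cap\mathrm{dom}(h_2)=\emptyset$ and $\mathrm{locs}(h_1)\cap\mathrm{locs}(h_2)\subseteq\mathrm{img}(s)$, else undefined ($\bot$). Atomic formulas: $\mathsf{emp}$, $x\mapsto y$, $\mathsf{ls}(x,y)$, $x=y$, $x\neq y$ with (strong) semantics: $\mathsf{emp}$ holds iff $\mathrm{dom}(h)=\emptyset$; $x=y$ (resp. $x\neq y$) iff $\mathrm{dom}(h)=\emptyset$ and $s(x)=s(y)$ (resp. $\neq$); $x\mapsto y$ iff $h=\{s(x)\mapsto s(y)\}$; $\mathsf{ls}(x,y)$ iff either $\mathrm{dom}(h)=\emptyset$ and $s(x)=s(y)$, or $h=\{l_0\mapsto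 l_1,\dots,l_{n-1}\mapsto l_n\}$ for some $n\ge1$ with $s(x)=l_0$, $s(y)=l_n$; $\neg,\wedge$ classical. Chunks: $h'$ is a sub-heap of $h$ if $h=h'\uplus^s h''$ for some $h''$. A chunk of $(s,h)$ is a nonempty sub-heap $h_c$ such that no sub-heap $h'$ of $h$ satisfies $\emptyset\neq h'\subsetneq h_c$; positive if $(s,h_c)\models\tau$ for some atomic $\tau$, negative otherwise. An abstract memory state (AMS) is a quadruple $\langle V,E,R,\gamma\rangle$: $V$ a partition of a finite set of variables into nonempty blocks; $E:V\rightharpoonup V\times\{{=}1,{\ge}2\}$ partial, no block in $\mathrm{dom}(E)$ containing $\mathsf{nil}$; $R$ a set of pairwise disjoint subsets of $V$, each disjoint from $\mathrm{dom}(E)$ and containing no block with $\mathsf{nil}$; $\gamma\in\mathbb{N}$. $\mathrm{alloc}(A)=\mathrm{dom}(E)\cup\bigcup R$. Induced AMS: $[x]_s=\{y\in\mathrm{dom}(s):s(y)=s(x)\}$, $\mathrm{cls}(s)=\{[x]_s\}$. $E_{s,h}([x]_s)=([y]_s,{=}1)$ if some $y\in\mathrm{dom}(s)$ and positive chunk $h_c$ satisfy $(s,h_c)\models x\mapsto y$; $=([y]_s,{\ge}2)$ if some $y$ and positive chunk satisfy $(s,h_c)\models\mathsf{ls}(x,y)\wedge\neg x\mapsto y$; undefined otherwise. $R_{s,h}=\{\{[x]_s:s(x)\in\mathrm{dom}(h_c)\}:h_c\text{ negative chunk}\}\setminus\{\emptyset\}$. $\mathrm{abst}(s,h)=\langle\mathrm{cls}(s),E_{s,h},R_{s,h},\gamma\rangle$,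 $\gamma$ = number of negative chunks $-|R_{s,h}|$. Composition: $A_i=\langle V_i,E_i,R_i,\gamma_i\rangle$ are compatible if $V_1=V_2$ and $\mathrm{alloc}(A_1)\cap\mathrm{alloc}(A_2)=\emptyset$; then $A_1\odot A_2=\langle V_1,E_1\cup E_2,R_1\cup R_2,\gamma_1+\gamma_2\rangle$; otherwise $A_1\odot A_2=\bot$. -}

module Defs where

open import Level using (Level; _⊔_) renaming (suc to lsuc; zero to lzero)
open import Data.Nat using (ℕ; zero; suc; _<_; _≤_; _∸_; _+_)
open import Data.Maybe using (Maybe; just; nothing)
open import Data.List using (List)
open import Data.List.Membership.Propositional using (_∈_)
open import Data.Vec using (Vec; lookup)
open import Data.Fin using (Fin)
open import Data.Product using (Σ; ∃; ∃₂; _×_; _,_)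
open import Data.Sum using (_⊎_)
open import Data.Empty using (⊥)
open import Relation.Nullary using (¬_)
open import Relation.Binary.PropositionalEquality using (_≡_; _≢_)

infix 3 _⇔_
_⇔_ : ∀ {a b} → Set a → Set b → Set (a ⊔ b)
A ⇔ B = (A → B) × (B → A)

SetEq : ∀ {a ℓ p q} {A : Set a} → (A → A → Set ℓ) →
        (A → Set p) → (A → Set q) → Set (a ⊔ ℓ ⊔ p ⊔ q)
SetEq {A = A} _≈_ P Q =
  (∀ x → P x → Σ A λ y → Q y × x ≈ y) ×
  (∀ y → Q y → Σ A λ x → P x × x ≈ y)

HasSize : ∀ {a ℓ p} {A : Set a} → (A → A → Set ℓ) → (A → Set p) → ℕ →
          Set (a ⊔ ℓ ⊔ p)
HasSize {A = A} _≈_ P n =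
  Σ (Vec A n) λ xs →
    (∀ i → P (lookup xs i)) ×
    (∀ i j → lookup xs i ≈ lookup xs j → i ≡ j) ×
    (∀ x → P x → Σ (Fin n) λ i → x ≈ lookup xs i)

Loc : Set
Loc = ℕ

Var : Set
Var = ℕ

nil : Var
nil = zero

Stack : Set
Stack = Var → Maybe Loc

record Heap : Set where
  constructor mkHeap
  field
    fun    : Loc → Maybe Loc
    finite : Σ (List Loc) λ xs → ∀ l v → fun l ≡ just v → l ∈ xs
open Heap public

domS : Stack → Var → Set
domS s x = Σ Loc λ l → s x ≡ just l

imgS : Stack → Loc → Set
imgS s l = Σ Var λ x → s x ≡ just l

domH : Heap → Loc → Set
domH h l = Σ Loc λ v → fun h l ≡ just v

imgH : Heap → Loc → Set
imgH h v = Σ Loc λ l → fun h l ≡ just v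

locs : Heap → Loc → Set
locs h l = domH h l ⊎ imgH h l

EmptyH : Heap → Set
EmptyH h = ∀ l → ¬ domH h l

NonEmptyH : Heap → Set
NonEmptyH h = Σ Loc λ l → domH h l

_⊆ʰ_ : Heap → Heap → Set
h ⊆ʰ h' = ∀ l v → fun h l ≡ just v → fun h' l ≡ just v

_≗ʰ_ : Heap → Heap → Set
h ≗ʰ h' = (h ⊆ʰ h') × (h' ⊆ʰ h)

record Model : Set where
  field
    stk    : Stack
    hp     : Heap
    nilDom : domS stk nil
    nilNA  : ∀ l → stk nil ≡ just l → ¬ domH hp l
open Model public

SepUnion : Stack → Heap → Heap → Heap → Set
SepUnion s h h₁ h₂ =
  (∀ l → domH h₁ l → domH h₂ l → ⊥) ×
  (∀ l → locs h₁ l → locs h₂ l → imgS s l) ×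
  (∀ l v → fun h l ≡ just v ⇔ (fun h₁ l ≡ just v ⊎ fun h₂ l ≡ just v))

SubHeap : Stack → Heap → Heap → Set
SubHeap s h' h = Σ Heap λ h'' → SepUnion s h h' h''

data Atom : Set where
  emp  : Atom
  _↦_  : Var → Var → Atom
  ls   : Var → Var → Atom
  _≐v_ : Var → Var → Atom
  _≠v_ : Var → Var → Atom

SameLoc : Stack → Var → Var → Set
SameLoc s x y = Σ Loc λ l → (s x ≡ just l) × (s y ≡ just l)

_,_⊨_ : Stack → Heap → Atom → Set
s , h ⊨ emp = EmptyH h
s , h ⊨ (x ≐v y) = EmptyH h × SameLoc s x y
s , h ⊨ (x ≠v y) = EmptyH h ×
  Σ Loc λ l → Σ Loc λ l' → (s x ≡ just l) × (s y ≡ just l') × l ≢ l'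
s , h ⊨ (x ↦ y) = Σ Loc λ lx → Σ Loc λ ly →
  (s x ≡ just lx) × (s y ≡ just ly) ×
  (∀ l v → fun h l ≡ just v ⇔ ((l ≡ lx) × (v ≡ ly)))
s , h ⊨ ls x y = (EmptyH h × SameLoc s x y) ⊎
  (Σ (ℕ → Loc) λ ℓ → Σ ℕ λ n → (1 ≤ n) ×
     (s x ≡ just (ℓ zero)) × (s y ≡ just (ℓ n)) ×
     (∀ l v → fun h l ≡ just v ⇔
        (Σ ℕ λ i → (i < n) × (l ≡ ℓ i) × (v ≡ ℓ (suc i)))))

_⊊ʰ_ : Heap → Heap → Set
h' ⊊ʰ hc = (h' ⊆ʰ hc) × ¬ (hc ⊆ʰ h')

Chunk : Stack → Heap → Heap → Set
Chunk s h hc = SubHeap s hc h × NonEmptyH hc ×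
  (∀ h' → SubHeap s h' h → ¬ (NonEmptyH h' × h' ⊊ʰ hc))

PosChunk : Stack → Heap → Heap → Set
PosChunk s h hc = Chunk s h hc × Σ Atom λ τ → s , hc ⊨ τ

NegChunk : Stack → Heap → Heap → Set
NegChunk s h hc = Chunk s h hc × ¬ (Σ Atom λ τ → s , hc ⊨ τ)

Block : Set₁
Block = Var → Set

_≐_ : Block → Block → Set
B ≐ B' = ∀ x → B x ⇔ B' x

data Label : Set where
  one : Label
  ge2 : Label

Edge : Set₁
Edge = Block × Block × Label

_≐E_ : Edge → Edge → Set
(B₁ , B₁' , l₁) ≐E (B₂ , B₂' , l₂) = (B₁ ≐ B₂) × (B₁' ≐ B₂') × (l₁ ≡ l₂)

_≋_ : (Block → Set) → (Block → Set) → Set₁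
F ≋ G = SetEq _≐_ F G

record AMS : Set₂ where
  constructor ⟨_,_,_,_⟩
  field
    V : Block → Set
    E : Edge → Set               -- graph of the partial function V ⇀ V × {=1,≥2}
    R : (Block → Set) → Set
    γ : ℕ
open AMS public

alloc : AMS → Block → Set₁
alloc A B = (Σ Block λ B' → Σ Label λ l → E A (B , B' , l)) ⊎
            (Σ (Block → Set) λ F → R A F × F B)

IsAMS : AMS → Set₁
IsAMS A =
  (∀ B → V A B → Σ Var λ x → B x) ×
  (∀ B B' x → V A B → V A B' → B x → B' x → B ≐ B') ×
  (Σ (List Var) λ xs → ∀ B x → V A B → B x → x ∈ xs) ×
  (∀ B B' l → E A (B , B' , l) → V A B × V A B') ×
  (∀ B₁ B₁' l₁ B₂ B₂' l₂ → E A (B₁ , B₁' , l₁) → E A (B₂ , B₂' , l₂) →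
     B₁ ≐ B₂ → (B₁' ≐ B₂') × (l₁ ≡ l₂)) ×
  (∀ B B' l → E A (B , B' , l) → ¬ B nil) ×
  (∀ F B → R A F → F B → V A B) ×
  (∀ F F' B B' → R A F → R A F' → F B → F' B' → B ≐ B' → F ≋ F') ×
  (∀ F B B' B'' l → R A F → F B → E A (B' , B'' , l) → ¬ (B ≐ B')) ×
  (∀ F B → R A F → F B → ¬ B nil)

Compatible : AMS → AMS → Set₁
Compatible A₁ A₂ =
  (V A₁ ≋ V A₂) ×
  (∀ B B' → alloc A₁ B → alloc A₂ B' → ¬ (B ≐ B'))

-- A₁ ⊙ A₂ (meaningful, i.e. ≠ ⊥, only when Compatible A₁ A₂)
_⊙_ : AMS → AMS → AMS
A₁ ⊙ A₂ = ⟨ V A₁ , (λ e → E A₁ e ⊎ E A₂ e) , (λ F → R A₁ F ⊎ R A₂ F) , γ A₁ + γ A₂ ⟩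

cl : Stack → Var → Block
cl s x y = SameLoc s x y

cls : Stack → Block → Set
cls s B = Σ Var λ x → domS s x × (B ≐ cl s x)

Eabs : Stack → Heap → Edge → Set
Eabs s h (B , B' , l) = Σ Var λ x → Σ Var λ y →
  domS s x × domS s y × (B ≐ cl s x) × (B' ≐ cl s y) ×
  (((l ≡ one) × Σ Heap λ hc → PosChunk s h hc × (s , hc ⊨ (x ↦ y))) ⊎
   ((l ≡ ge2) × Σ Heap λ hc → PosChunk s h hc ×
        (s , hc ⊨ ls x y) × ¬ (s , hc ⊨ (x ↦ y))))

chunkBlocks : Stack → Heap → Block → Set
chunkBlocks s hc B = Σ Var λ x → (B ≐ cl s x) ×
  (Σ Loc λ l → (s x ≡ just l) × domH hc l)

Rabs : Stack → Heap → (Block → Set) → Set₁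
Rabs s h F = Σ Heap λ hc → NegChunk s h hc ×
  (F ≋ chunkBlocks s hc) × (Σ Block λ B → chunkBlocks s hc B)

-- abst(s,h) = A  (equality of AMS, sets compared extensionally)
Abst : Stack → Heap → AMS → Set₁
Abst s h A =
  (V A ≋ cls s) ×
  SetEq _≐E_ (E A) (Eabs s h) ×
  SetEq _≋_ (R A) (Rabs s h) ×
  (Σ ℕ λ k → Σ ℕ λ r →
     HasSize _≗ʰ_ (NegChunk s h) k ×
     HasSize _≋_ (Rabs s h) r ×
     (γ A ≡ k ∸ r))

{-# OPTIONS --safe #-}
module Submission where

-- The chunks of h are the connected components of the relation that links two cells sharing a
-- location outside img(s); h is the strong disjoint union of its chunks, and the restriction of h
-- to a union of chunks is a sub-heap whose chunks are exactly those chunks. So it suffices to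
-- deal the chunks of h out to the two sides. A positive chunk is a list segment with a unique
-- labelled start, so it realises exactly one edge of E₁ ∪ E₂, and compatibility (disjoint
-- allocated blocks) decides its side; a negative chunk containing a labelled location realises an
-- element of R₁ ∪ R₂ and goes with it; of the anonymous negative chunks, of which there are
-- γ₁ + γ₂, the first γ₁ go to the first side and the rest to the second. The assignment is
-- computable because heaps and the domain of the stack are finite, which makes membership in a
-- chunk and being a list segment decidable.

open import Defs
open import Data.Bool using (Bool; true; false; not; _∧_; if_then_else_)
import Data.Bool as Bool
open import Data.Bool.Properties using (∧-zeroʳ; ∧-identityʳ; ¬-not)
open import Data.Empty using (⊥; ⊥-elim)
open import Data.Fin using (Fin; zero; suc; toℕ)
import Data.Fin.Properties as Fin
open import Data.Fin.Properties using (pigeonhole; toℕ<n; injective⇒≤)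
open import Data.List using (List; []; _∷_; map; _++_; length; filter; lookup)
  renaming (find to findFirst; fromMaybe to maybeToList)
open import Data.List.Membership.Propositional using (_∈_; find; lose)
open import Data.List.Membership.Propositional.Properties
  using (∈-++⁺ˡ; ∈-++⁺ʳ; ∈-map⁺; ∈-filter⁺; ∈-filter⁻)
open import Data.List.Relation.Unary.All as All using (All; all?)
open import Data.List.Relation.Unary.All.Properties using (¬All⇒Any¬)
open import Data.List.Relation.Unary.Any using (here; there; any?; index)
open import Data.List.Relation.Unary.Any.Properties using (lookup-index)
open import Data.Maybe using (Maybe; just; nothing; fromMaybe)
open import Data.Maybe.Properties using (just-injective) renaming (≡-dec to ≡-decᴹ)
open import Data.Nat using (ℕ; zero; suc; _+_; _∸_; _⊓_; _<ᵇ_; _<_; _≤_; z≤n; s≤s; s≤s⁻¹; _≟_; _<?_; _≤?_)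
open import Data.Nat.Induction using (<-wellFounded)
open import Data.Nat.Properties
open import Data.List.Membership.DecPropositional _≟_ using (_∈?_)
open import Data.Product using (Σ; _×_; _,_; proj₁; proj₂)
open import Data.Sum using (_⊎_; inj₁; inj₂; [_,_]′)
import Data.Sum
open import Data.Vec using (Vec; []; _∷_)
import Data.Vec as Vec
open import Data.Vec.Properties using (lookup-map)
open import Function using (id; _∘_)
open import Induction.WellFounded using (Acc; acc)
open import Relation.Binary.Definitions using (tri<; tri≈; tri>)
open import Relation.Binary.PropositionalEquality
open import Relation.Nullary using (¬_; Dec; yes; no; does; contradiction)
open import Relation.Nullary.Decidable using (_×-dec_; _⊎-dec_; _→-dec_; ¬?; map′; decidable-stable; dec-true)
open import Relation.Unary using (Decidable)

≐-refl : {B : Block} → B ≐ B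
≐-refl x = id , id

≐-sym : {B B' : Block} → B ≐ B' → B' ≐ B
≐-sym e x = proj₂ (e x) , proj₁ (e x)

≐-trans : {B B' B'' : Block} → B ≐ B' → B' ≐ B'' → B ≐ B''
≐-trans e f x = proj₁ (f x) ∘ proj₁ (e x) , proj₂ (e x) ∘ proj₂ (f x)

≋-refl : {F : Block → Set} → F ≋ F
≋-refl = (λ B p → B , p , ≐-refl) , (λ B p → B , p , ≐-refl)

≋-sym : {F G : Block → Set} → F ≋ G → G ≋ F
≋-sym (f , g) = (λ B p → let (B' , q , e) = g B p in B' , q , ≐-sym e) ,
                (λ B p → let (B' , q , e) = f B p in B' , q , ≐-sym e)

≋-trans : {F G H : Block → Set} → F ≋ G → G ≋ H → F ≋ H
≋-trans (f , f') (g , g') =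
  (λ B p → let (B' , q , e) = f B p ; (B'' , r , e') = g B' q in B'' , r , ≐-trans e e') ,
  (λ B p → let (B' , q , e) = g' B p ; (B'' , r , e') = f' B' q in B'' , r , ≐-trans e' e)

⊆ʰ-trans : {H H' H'' : Heap} → H ⊆ʰ H' → H' ⊆ʰ H'' → H ⊆ʰ H''
⊆ʰ-trans a b l v = b l v ∘ a l v

≗ʰ-sym : {H H' : Heap} → H ≗ʰ H' → H' ≗ʰ H
≗ʰ-sym (a , b) = b , a

≗ʰ-trans : {H H' H'' : Heap} → H ≗ʰ H' → H' ≗ʰ H'' → H ≗ʰ H''
≗ʰ-trans {H} {H'} {H''} (a , b) (c , d) = ⊆ʰ-trans {H} {H'} {H''} a c , ⊆ʰ-trans {H''} {H'} {H} d b

⊆ʰ-agrees : {H H' : Heap} {l u : Loc} → H ⊆ʰ H' → domH H l → fun H' l ≡ just u → fun H l ≡ just u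
⊆ʰ-agrees H⊆ (v , e) e' = trans e (cong just (just-injective (trans (sym (H⊆ _ v e)) e')))

≗ʰ⇒fun-≡ : {H H' : Heap} → H ≗ʰ H' → ∀ l → fun H l ≡ fun H' l
≗ʰ⇒fun-≡ {H} {H'} (H⊆ , H'⊆) l with fun H l in e
... | just v = sym (H⊆ l v e)
... | nothing with fun H' l in e'
...   | nothing = refl
...   | just w = contradiction (trans (sym e) (H'⊆ l w e')) λ ()

dom? : (H : Heap) → Decidable (domH H)
dom? H l with fun H l
... | just v = yes (v , refl)
... | nothing = no λ ()

⊆ʰ? : (H H' : Heap) → Dec (H ⊆ʰ H')
⊆ʰ? H H' = map′ (λ all l v e → All.lookup all (proj₂ (finite H) l v e) v e)
                (λ H⊆ → All.tabulate λ {l} _ → H⊆ l)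
                (all? agrees? (proj₁ (finite H)))
  where
  agrees? : ∀ l → Dec (∀ v → fun H l ≡ just v → fun H' l ≡ just v)
  agrees? l with fun H l
  ... | nothing = yes λ _ ()
  ... | just w = map′ (λ { e _ refl → e }) (λ f → f w refl) (≡-decᴹ _≟_ (fun H' l) (just w))

≗ʰ? : (H H' : Heap) → Dec (H ≗ʰ H')
≗ʰ? H H' = ⊆ʰ? H H' ×-dec ⊆ʰ? H' H

cl-≐ : {s : Stack} {x x' : Var} {a : Loc} → s x ≡ just a → s x' ≡ just a → cl s x ≐ cl s x'
cl-≐ e e' z = (λ (l , p , q) → l , trans e' (trans (sym e) p) , q) ,
              (λ (l , p , q) → l , trans e (trans (sym e') p) , q)

chunkBlocks-resp-≗ʰ : {s : Stack} {H H' : Heap} → H ≗ʰ H' → chunkBlocks s H ≋ chunkBlocks s H'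
chunkBlocks-resp-≗ʰ eq =
  (λ B (x , e , l , ex , (v , d)) → B , (x , e , l , ex , (v , proj₁ eq l v d)) , ≐-refl) ,
  (λ B (x , e , l , ex , (v , d)) → B , (x , e , l , ex , (v , proj₂ eq l v d)) , ≐-refl)

⊨-resp-≗ʰ : {s : Stack} {H H' : Heap} (τ : Atom) → H ≗ʰ H' → s , H ⊨ τ → s , H' ⊨ τ
⊨-resp-≗ʰ {s} {H} {H'} τ (H⊆ , H'⊆) = go τ
  where
  empty : EmptyH H → EmptyH H'
  empty em l (v , e) = em l (v , H'⊆ l v e)
  graph : {Q : Loc → Loc → Set} → (∀ l v → fun H l ≡ just v ⇔ Q l v) → (∀ l v → fun H' l ≡ just v ⇔ Q l v)
  graph g l v = proj₁ (g l v) ∘ H'⊆ l v , H⊆ l v ∘ proj₂ (g l v)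
  go : (τ : Atom) → s , H ⊨ τ → s , H' ⊨ τ
  go emp em = empty em
  go (x ↦ y) (lx , ly , ex , ey , g) = lx , ly , ex , ey , graph g
  go (ls x y) (inj₁ (em , eq)) = inj₁ (empty em , eq)
  go (ls x y) (inj₂ (ℓ , n , 1≤n , ex , ey , g)) = inj₂ (ℓ , n , 1≤n , ex , ey , graph g)
  go (x ≐v y) (em , eq) = empty em , eq
  go (x ≠v y) (em , ne) = empty em , ne

module _ {P : Loc → Set} (H : Heap) (P? : Decidable P) where

  restrict : Heap
  restrict = mkHeap (λ l → if does (P? l) then fun H l else nothing) (proj₁ (finite H) , fin)
    where
    fin : ∀ l v → (if does (P? l) then fun H l else nothing) ≡ just v → l ∈ proj₁ (finite H)
    fin l v e with P? l
    ... | yes _ = proj₂ (finite H) l v e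

  restrict-⊆ʰ : restrict ⊆ʰ H
  restrict-⊆ʰ l v e with P? l
  ... | yes _ = e

  restrict-sat : ∀ {l v} → fun restrict l ≡ just v → P l
  restrict-sat {l} e with P? l
  ... | yes p = p

  restrict-keeps : ∀ {l v} → P l → fun H l ≡ just v → fun restrict l ≡ just v
  restrict-keeps {l} p e with P? l
  ... | yes _ = e
  ... | no ¬p = contradiction p ¬p

restrict-cong : {P Q : Loc → Set} (H : Heap) (P? : Decidable P) (Q? : Decidable Q) →
                (∀ {l} → domH H l → P l → Q l) → (∀ {l} → domH H l → Q l → P l) →
                restrict H P? ≗ʰ restrict H Q?
restrict-cong H P? Q? P⇒Q Q⇒P =
  (λ l v e → let e' = restrict-⊆ʰ H P? l v e in restrict-keeps H Q? (P⇒Q (v , e') (restrict-sat H P? e)) e') ,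
  (λ l v e → let e' = restrict-⊆ʰ H Q? l v e in restrict-keeps H P? (Q⇒P (v , e') (restrict-sat H Q? e)) e')

∃?-within : {A : Set} {P : A → Set} (L : List A) → (∀ {a} → P a → a ∈ L) → Decidable P → Dec (Σ A P)
∃?-within L complete P? with any? P? L
... | yes p = let (a , _ , pa) = find p in yes (a , pa)
... | no ¬p = no λ (a , pa) → ¬p (lose (complete pa) pa)

∃-just? : {A : Set} {P : A → Set} (m : Maybe A) → Decidable P → Dec (Σ A λ a → m ≡ just a × P a)
∃-just? nothing P? = no λ ()
∃-just? (just a) P? with P? a
... | yes p = yes (a , refl , p)
... | no ¬p = no λ { (_ , refl , p) → ¬p p }

sublists : {A : Set} → List A → List (List A)
sublists [] = [] ∷ []
sublists (x ∷ L) = map (x ∷_) (sublists L) ++ sublists L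

filter∈sublists : {A : Set} {P : A → Set} (P? : Decidable P) (L : List A) → filter P? L ∈ sublists L
filter∈sublists P? [] = here refl
filter∈sublists P? (x ∷ L) with does (P? x)
... | true = ∈-++⁺ˡ (∈-map⁺ (x ∷_) (filter∈sublists P? L))
... | false = ∈-++⁺ʳ (map (x ∷_) (sublists L)) (filter∈sublists P? L)

module _ {A : Set} {P : A → Set} (P? : Decidable P) where

  findFirst-sound : ∀ L {z} → findFirst P? L ≡ just z → P z × z ∈ L
  findFirst-sound (x ∷ L) e with P? x
  findFirst-sound (x ∷ L) refl | yes p = p , here refl
  ... | no _ = let (p , z∈L) = findFirst-sound L e in p , there z∈L

  findFirst-complete : ∀ {L x} → x ∈ L → P x → Σ A λ z → findFirst P? L ≡ just z
  findFirst-complete {y ∷ L} x∈L px with P? y | x∈L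
  ... | yes _ | _ = y , refl
  ... | no ¬py | here refl = contradiction px ¬py
  ... | no _ | there x∈L′ = findFirst-complete x∈L′ px

findFirst-cong : {A : Set} {P Q : A → Set} (P? : Decidable P) (Q? : Decidable Q) →
                 (∀ {z} → P z → Q z) → (∀ {z} → Q z → P z) → ∀ L → findFirst P? L ≡ findFirst Q? L
findFirst-cong P? Q? P⇒Q Q⇒P [] = refl
findFirst-cong P? Q? P⇒Q Q⇒P (x ∷ L) with P? x | Q? x
... | yes _ | yes _ = refl
... | no _ | no _ = findFirst-cong P? Q? P⇒Q Q⇒P L
... | yes p | no ¬q = contradiction (P⇒Q p) ¬q
... | no ¬p | yes q = contradiction (Q⇒P q) ¬p

¬→⇒×¬ : {A B : Set} → Dec A → ¬ (A → B) → A × ¬ B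
¬→⇒×¬ (yes a) ¬f = a , λ b → ¬f λ _ → b
¬→⇒×¬ (no ¬a) ¬f = ⊥-elim (¬f λ a → ⊥-elim (¬a a))

least-witness : {P : ℕ → Set} → Decidable P → ∀ {n} → P n →
                Σ ℕ λ m → P m × m ≤ n × (∀ {k} → k < m → ¬ P k)
least-witness {P} P? {n} = go n (<-wellFounded n)
  where
  go : ∀ n → Acc _<_ n → P n → Σ ℕ λ m → P m × m ≤ n × (∀ {k} → k < m → ¬ P k)
  go n (acc smaller) pn with anyUpTo? P? n
  ... | no none = n , pn , ≤-refl , λ k<n pk → none (_ , k<n , pk)
  ... | yes (k , k<n , pk) = let (m , pm , m≤k , least) = go k (smaller k<n) pk in
                             m , pm , ≤-trans m≤k (<⇒≤ k<n) , least

which : {A B : Set} → A ⊎ B → Bool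
which (inj₁ _) = true
which (inj₂ _) = false

which-inj₁ : {A B : Set} (u : A ⊎ B) → which u ≡ true → A
which-inj₁ (inj₁ a) _ = a

which-inj₂ : {A B : Set} (u : A ⊎ B) → which u ≡ false → B
which-inj₂ (inj₂ b) _ = b

_==_ : Bool → Bool → Bool
x == true = x
x == false = not x

==⇒≡ : ∀ x b → x == b ≡ true → x ≡ b
==⇒≡ x true e = e
==⇒≡ false false _ = refl

≡⇒== : ∀ {x b} → x ≡ b → x == b ≡ true
≡⇒== {true} refl = refl
≡⇒== {false} refl = refl

∧-true⁻ : ∀ {x y} → x ∧ y ≡ true → x ≡ true × y ≡ true
∧-true⁻ {true} e = refl , e

∧-true⁺ : ∀ {x y} → x ≡ true → y ≡ true → x ∧ y ≡ true
∧-true⁺ refl e = e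

-- Counting selected indices

sucIf : Bool → ℕ → ℕ
sucIf true n = suc n
sucIf false n = n

count : ∀ {k} → (Fin k → Bool) → ℕ
count {zero} _ = 0
count {suc k} p = sucIf (p zero) (count (p ∘ suc))

rank : ∀ {k} → (Fin k → Bool) → Fin k → ℕ
rank p zero = 0
rank p (suc i) = sucIf (p zero) (rank (p ∘ suc) i)

count-cong : ∀ {k} (p q : Fin k → Bool) → (∀ i → p i ≡ q i) → count p ≡ count q
count-cong {zero} p q e = refl
count-cong {suc k} p q e = cong₂ sucIf (e zero) (count-cong (p ∘ suc) (q ∘ suc) (e ∘ suc))

count-false : ∀ {k} → count {k} (λ _ → false) ≡ 0
count-false {zero} = refl
count-false {suc k} = count-false {k}

count-true : ∀ {k} → count {k} (λ _ → true) ≡ k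
count-true {zero} = refl
count-true {suc k} = cong suc (count-true {k})

count-split : ∀ {k} (p q : Fin k → Bool) → count p ≡ count (λ i → p i ∧ q i) + count (λ i → p i ∧ not (q i))
count-split {zero} p q = refl
count-split {suc k} p q = step (p zero) (q zero) (count-split (p ∘ suc) (q ∘ suc))
  where
  step : ∀ a c {x y z} → x ≡ y + z → sucIf a x ≡ sucIf (a ∧ c) y + sucIf (a ∧ not c) z
  step false c e = e
  step true true e = cong suc e
  step true false {y = y} {z} e = trans (cong suc e) (sym (+-suc y z))

count-rank< : ∀ {k} (p : Fin k → Bool) γ → count (λ i → p i ∧ (rank p i <ᵇ γ)) ≡ γ ⊓ count p
count-rank< {zero} p zero = refl
count-rank< {zero} p (suc γ) = refl
count-rank< {suc k} p γ = step (p zero) γ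
  where
  step : ∀ b γ → sucIf (b ∧ (0 <ᵇ γ)) (count (λ i → p (suc i) ∧ (sucIf b (rank (p ∘ suc) i) <ᵇ γ))) ≡
                 γ ⊓ sucIf b (count (p ∘ suc))
  step false γ = count-rank< (p ∘ suc) γ
  step true zero = trans (count-cong _ _ (λ i → ∧-zeroʳ (p (suc i)))) (count-false {k})
  step true (suc γ) = cong suc (count-rank< (p ∘ suc) γ)

count-rank≥ : ∀ {k} (p : Fin k → Bool) γ → count (λ i → p i ∧ not (rank p i <ᵇ γ)) ≡ count p ∸ γ
count-rank≥ {zero} p zero = refl
count-rank≥ {zero} p (suc γ) = refl
count-rank≥ {suc k} p γ = step (p zero) γ
  where
  step : ∀ b γ → sucIf (b ∧ not (0 <ᵇ γ)) (count (λ i → p (suc i) ∧ not (sucIf b (rank (p ∘ suc) i) <ᵇ γ))) ≡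
                 sucIf b (count (p ∘ suc)) ∸ γ
  step false γ = count-rank≥ (p ∘ suc) γ
  step true zero = cong suc (count-cong _ _ (λ i → ∧-identityʳ (p (suc i))))
  step true (suc γ) = count-rank≥ (p ∘ suc) γ

consIf : {A : Set} {n : ℕ} (b : Bool) → A → Vec A n → Vec A (sucIf b n)
consIf true a v = a ∷ v
consIf false a v = v

enumerate : ∀ {k} (p : Fin k → Bool) → Vec (Fin k) (count p)
enumerate {zero} p = []
enumerate {suc k} p = consIf (p zero) zero (Vec.map suc (enumerate (p ∘ suc)))

consIf-all : {A : Set} {n : ℕ} (P : A → Set) (b : Bool) (a : A) (v : Vec A n) →
             (b ≡ true → P a) → (∀ j → P (Vec.lookup v j)) → ∀ j → P (Vec.lookup (consIf b a v) j)
consIf-all P true a v pa pv zero = pa refl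
consIf-all P true a v pa pv (suc j) = pv j
consIf-all P false a v pa pv j = pv j

consIf-injective : {A : Set} {n : ℕ} (b : Bool) (a : A) (v : Vec A n) → (∀ j → Vec.lookup v j ≢ a) →
                   (∀ j j' → Vec.lookup v j ≡ Vec.lookup v j' → j ≡ j') →
                   ∀ j j' → Vec.lookup (consIf b a v) j ≡ Vec.lookup (consIf b a v) j' → j ≡ j'
consIf-injective true a v fresh inj zero zero e = refl
consIf-injective true a v fresh inj zero (suc j') e = ⊥-elim (fresh j' (sym e))
consIf-injective true a v fresh inj (suc j) zero e = ⊥-elim (fresh j e)
consIf-injective true a v fresh inj (suc j) (suc j') e = cong suc (inj j j' e)
consIf-injective false a v fresh inj j j' e = inj j j' e

consIf-keeps : {A : Set} {n : ℕ} (b : Bool) (a : A) (v : Vec A n) (j : Fin n) →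
               Σ (Fin (sucIf b n)) λ j' → Vec.lookup (consIf b a v) j' ≡ Vec.lookup v j
consIf-keeps true a v j = suc j , refl
consIf-keeps false a v j = j , refl

enumerate-sound : ∀ {k} (p : Fin k → Bool) j → p (Vec.lookup (enumerate p) j) ≡ true
enumerate-sound {suc k} p = consIf-all (λ z → p z ≡ true) (p zero) zero _ id λ j →
  subst (λ z → p z ≡ true) (sym (lookup-map j suc (enumerate (p ∘ suc)))) (enumerate-sound (p ∘ suc) j)

enumerate-injective : ∀ {k} (p : Fin k → Bool) j j' →
                      Vec.lookup (enumerate p) j ≡ Vec.lookup (enumerate p) j' → j ≡ j'
enumerate-injective {suc k} p = consIf-injective (p zero) zero _
  (λ j e → Fin.0≢1+n (sym (trans (sym (lookup-map j suc (enumerate (p ∘ suc)))) e)))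
  (λ j j' e → enumerate-injective (p ∘ suc) j j'
     (Fin.suc-injective (trans (sym (lookup-map j suc (enumerate (p ∘ suc))))
                        (trans e (lookup-map j' suc (enumerate (p ∘ suc)))))))

enumerate-complete : ∀ {k} (p : Fin k → Bool) i → p i ≡ true →
                     Σ (Fin (count p)) λ j → Vec.lookup (enumerate p) j ≡ i
enumerate-complete {suc k} p zero e rewrite e = zero , refl
enumerate-complete {suc k} p (suc i) e =
  let (j , ej) = enumerate-complete (p ∘ suc) i e
      (j' , ej') = consIf-keeps (p zero) zero (Vec.map suc (enumerate (p ∘ suc))) j
  in j' , trans ej' (trans (lookup-map j suc (enumerate (p ∘ suc))) (cong suc ej))

hasSize-count : ∀ {a ℓ q} {A : Set a} {_≈_ : A → A → Set ℓ} {P : A → Set q} {k}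
                (f : Fin k → A) (p : Fin k → Bool) →
                (∀ {i} → p i ≡ true → P (f i)) →
                (∀ {i j} → p i ≡ true → f i ≈ f j → i ≡ j) →
                (∀ {x} → P x → Σ (Fin k) λ i → p i ≡ true × x ≈ f i) →
                HasSize _≈_ P (count p)
hasSize-count {_≈_ = _≈_} {P} f p sat inj cover = Vec.map f (enumerate p) , each , distinct , covered
  where
  at : ∀ j → Vec.lookup (Vec.map f (enumerate p)) j ≡ f (Vec.lookup (enumerate p) j)
  at j = lookup-map j f (enumerate p)
  each : ∀ j → P (Vec.lookup (Vec.map f (enumerate p)) j)
  each j = subst P (sym (at j)) (sat (enumerate-sound p j))
  distinct : ∀ j j' → Vec.lookup (Vec.map f (enumerate p)) j ≈ Vec.lookup (Vec.map f (enumerate p)) j' → j ≡ j'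
  distinct j j' eq = enumerate-injective p j j' (inj (enumerate-sound p j) (subst₂ _≈_ (at j) (at j') eq))
  covered : ∀ x → P x → Σ (Fin (count p)) λ j → x ≈ Vec.lookup (Vec.map f (enumerate p)) j
  covered x px = let (i , pi , x≈) = cover px ; (j , ej) = enumerate-complete p i pi in
    j , subst (x ≈_) (trans (cong f (sym ej)) (sym (at j))) x≈

hasSize-≤ : ∀ {a ℓ q} {A : Set a} {_≈_ : A → A → Set ℓ} {P : A → Set q} {n m} →
            (∀ {x y} → x ≈ y → y ≈ x) → (∀ {x y z} → x ≈ y → y ≈ z → x ≈ z) →
            HasSize _≈_ P n → HasSize _≈_ P m → n ≤ m
hasSize-≤ {_≈_ = _≈_} sym≈ trans≈ (v₁ , P₁ , distinct₁ , _) (v₂ , _ , _ , cov₂) =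
  injective⇒≤ {f = position} λ {i} {j} e →
    distinct₁ i j (trans≈ (subst (λ z → Vec.lookup v₁ i ≈ Vec.lookup v₂ z) e (proj₂ (cov₂ _ (P₁ i))))
                          (sym≈ (proj₂ (cov₂ _ (P₁ j)))))
  where
  position : Fin _ → Fin _
  position i = proj₁ (cov₂ (Vec.lookup v₁ i) (P₁ i))

hasSize-unique : ∀ {a ℓ q} {A : Set a} {_≈_ : A → A → Set ℓ} {P : A → Set q} {n m} →
                 (∀ {x y} → x ≈ y → y ≈ x) → (∀ {x y z} → x ≈ y → y ≈ z → x ≈ z) →
                 HasSize _≈_ P n → HasSize _≈_ P m → n ≡ m
hasSize-unique sym≈ trans≈ a b = ≤-antisym (hasSize-≤ sym≈ trans≈ a b) (hasSize-≤ sym≈ trans≈ b a)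

-- Walks along a heap

module Walks (C : Heap) where

  -- Off the domain `next` returns the junk location 0; walks are only inspected inside the domain.
  next : Loc → Loc
  next l = fromMaybe 0 (fun C l)

  next-≡ : ∀ {m u} → fun C m ≡ just u → next m ≡ u
  next-≡ e rewrite e = refl

  walk : Loc → ℕ → Loc
  walk a zero = a
  walk a (suc t) = next (walk a t)

  walk-+ : ∀ a t u → walk a (u + t) ≡ walk (walk a t) u
  walk-+ a t zero = refl
  walk-+ a t (suc u) = cong next (walk-+ a t u)

  walk-shift : ∀ a {t t'} u → walk a t ≡ walk a t' → walk a (u + t) ≡ walk a (u + t')
  walk-shift a {t} {t'} u e = trans (walk-+ a t u) (trans (cong (λ z → walk z u) e) (sym (walk-+ a t' u)))

  Covers : Loc → ℕ → Set
  Covers a n = (∀ {t} → t < n → domH C (walk a t)) × (∀ {m} → domH C m → Σ ℕ λ t → t < n × walk a t ≡ m)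

  SegmentGraph : (ℕ → Loc) → ℕ → Set
  SegmentGraph ℓ n = ∀ l v → fun C l ≡ just v ⇔ (Σ ℕ λ i → (i < n) × (l ≡ ℓ i) × (v ≡ ℓ (suc i)))

  PointsToGraph : Loc → Loc → Set
  PointsToGraph lx ly = ∀ l v → fun C l ≡ just v ⇔ ((l ≡ lx) × (v ≡ ly))

  segment-walk : ∀ {ℓ n} → SegmentGraph ℓ n → ∀ {t} → t ≤ n → ℓ t ≡ walk (ℓ 0) t
  segment-walk g {zero} _ = refl
  segment-walk {ℓ} g {suc t} t<n =
    trans (sym (next-≡ (proj₂ (g (ℓ t) (ℓ (suc t))) (t , t<n , refl , refl)))) (cong next (segment-walk g (<⇒≤ t<n)))

  segment⇒covers : ∀ {ℓ n} → SegmentGraph ℓ n → Covers (ℓ 0) n × walk (ℓ 0) n ≡ ℓ n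
  segment⇒covers {ℓ} {n} g = (inDom , onWalk) , sym (segment-walk g ≤-refl)
    where
    inDom : ∀ {t} → t < n → domH C (walk (ℓ 0) t)
    inDom {t} t<n = subst (domH C) (segment-walk g (<⇒≤ t<n))
                      (ℓ (suc t) , proj₂ (g (ℓ t) (ℓ (suc t))) (t , t<n , refl , refl))
    onWalk : ∀ {m} → domH C m → Σ ℕ λ t → t < n × walk (ℓ 0) t ≡ m
    onWalk {m} (v , e) = let (i , i<n , m≡ , _) = proj₁ (g m v) e in
      i , i<n , trans (sym (segment-walk g (<⇒≤ i<n))) (sym m≡)

  covers⇒segment : ∀ {a n} → Covers a n → SegmentGraph (walk a) n
  covers⇒segment {a} (inDom , onWalk) l v = to , from
    where
    to : fun C l ≡ just v → Σ ℕ λ i → (i < _) × (l ≡ walk a i) × (v ≡ walk a (suc i))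
    to e = let (t , t<n , w≡) = onWalk (v , e) in t , t<n , sym w≡ , trans (sym (next-≡ e)) (cong next (sym w≡))
    from : (Σ ℕ λ i → (i < _) × (l ≡ walk a i) × (v ≡ walk a (suc i))) → fun C l ≡ just v
    from (i , i<n , refl , refl) = let (w , e) = inDom i<n in subst (λ z → fun C (walk a i) ≡ just z) (sym (next-≡ e)) e

  pointsTo⇒covers : ∀ {lx ly} → PointsToGraph lx ly → Covers lx 1 × walk lx 1 ≡ ly
  pointsTo⇒covers {lx} {ly} g = (inDom , onWalk) , next-≡ (proj₂ (g lx ly) (refl , refl))
    where
    inDom : ∀ {t} → t < 1 → domH C (walk lx t)
    inDom {zero} _ = ly , proj₂ (g lx ly) (refl , refl)
    inDom {suc _} (s≤s ())
    onWalk : ∀ {m} → domH C m → Σ ℕ λ t → t < 1 × walk lx t ≡ m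
    onWalk {m} (v , e) = 0 , s≤s z≤n , sym (proj₁ (proj₁ (g m v) e))

  covers⇒pointsTo : ∀ {a} → Covers a 1 → PointsToGraph a (walk a 1)
  covers⇒pointsTo {a} (inDom , onWalk) l v = to , from
    where
    to : fun C l ≡ just v → (l ≡ a) × (v ≡ walk a 1)
    to e with onWalk (v , e)
    ... | zero , _ , refl = refl , sym (next-≡ e)
    ... | suc _ , s≤s () , _
    from : (l ≡ a) × (v ≡ walk a 1) → fun C l ≡ just v
    from (refl , refl) = let (w , e) = inDom (s≤s z≤n) in subst (λ z → fun C a ≡ just z) (sym (next-≡ e)) e

  covers? : ∀ a n → Dec (Covers a n)
  covers? a n with allUpTo? (λ t → dom? C (walk a t)) n
                 | all? (λ m → dom? C m →-dec anyUpTo? (λ t → walk a t ≟ m) n) (proj₁ (finite C))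
  ... | yes inDom | yes onWalk = yes (inDom , λ {m} (v , e) → All.lookup onWalk (proj₂ (finite C) m v e) (v , e))
  ... | no ¬inDom | _ = no (¬inDom ∘ proj₁)
  ... | yes _ | no ¬onWalk = no λ (_ , onWalk) → ¬onWalk (All.tabulate λ _ → onWalk)

  walk-repeats : ∀ {a} → (∀ {t} → t ≤ length (proj₁ (finite C)) → domH C (walk a t)) →
                 Σ ℕ λ i → Σ ℕ λ j → i < j × j ≤ length (proj₁ (finite C)) × walk a i ≡ walk a j
  walk-repeats {a} inDom =
    let (i , j , i<j , same) = pigeonhole (n<1+n _) (index ∘ cell)
    in toℕ i , toℕ j , i<j , s≤s⁻¹ (toℕ<n j) ,
       trans (lookup-index (cell i)) (trans (cong (lookup (proj₁ (finite C))) same) (sym (lookup-index (cell j))))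
    where
    cell : (i : Fin (suc (length (proj₁ (finite C))))) → walk a (toℕ i) ∈ proj₁ (finite C)
    cell i = let (v , e) = inDom (s≤s⁻¹ (toℕ<n i)) in proj₂ (finite C) _ v e

  split-≤ : ∀ {j t} → j ≤ t → Σ ℕ λ v → t ≡ v + j
  split-≤ {j} {t} j≤t = t ∸ j , sym (m∸n+n≡m j≤t)

  cut-loop : ∀ {a i j} u → i < j → j ≤ u → walk a i ≡ walk a j → Covers a (u + j) →
             Covers a (u + i) × walk a (u + i) ≡ walk a (u + j)
  cut-loop {a} {i} {j} u i<j j≤u loop (inDom , onWalk) = (inDom ∘ shorter , onShorter) , walk-shift a u loop
    where
    shorter : ∀ {t} → t < u + i → t < u + j
    shorter t< = <-≤-trans t< (+-monoʳ-≤ u (<⇒≤ i<j))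
    onShorter : ∀ {m} → domH C m → Σ ℕ λ t → t < u + i × walk a t ≡ m
    onShorter dm with onWalk dm
    ... | t , t<n , e with t <? u + i
    ...   | yes t<n' = t , t<n' , e
    ...   | no t≮n' =
      let (v , t≡) = split-≤ (≤-trans j≤u (≤-trans (m≤m+n u i) (≮⇒≥ t≮n')))
      in v + i , +-monoˡ-< i (+-cancelʳ-< j v u (subst (_< u + j) t≡ t<n)) ,
         trans (walk-shift a v loop) (trans (cong (walk a) (sym t≡)) e)

  bound : ℕ
  bound = suc (length (proj₁ (finite C)) + length (proj₁ (finite C)))

  shorten : ∀ {a n} → Covers a n → bound < n →
            Σ ℕ λ n' → n' < n × 1 ≤ n' × Covers a n' × walk a n' ≡ walk a n
  shorten {a} {n} cov bound<n =
    let (i , j , i<j , j≤N , loop) = walk-repeats (λ t≤N → proj₁ cov (≤-<-trans t≤N N<n))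
        (u , n≡) = split-≤ (≤-trans j≤N (<⇒≤ N<n))
        N<u = N<u′ u j≤N (subst (bound <_) n≡ bound<n)
        (cov' , same) = cut-loop u i<j (≤-trans j≤N (<⇒≤ N<u)) loop (subst (Covers a) n≡ cov)
    in u + i , subst (u + i <_) (sym n≡) (+-monoʳ-< u i<j) , ≤-trans (≤-<-trans z≤n N<u) (m≤m+n u i) ,
       cov' , trans same (cong (walk a) (sym n≡))
    where
    N : ℕ
    N = length (proj₁ (finite C))
    N<n : N < n
    N<n = <-trans (s≤s (m≤m+n N N)) bound<n
    N<u′ : ∀ u {j} → j ≤ N → bound < u + j → N < u
    N<u′ u {j} j≤N b< with N <? u
    ... | yes N<u = N<u
    ... | no N≮u = contradiction (≤-trans (+-mono-≤ (≮⇒≥ N≮u) j≤N) (n≤1+n (N + N))) (<⇒≱ b<)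

  covers-bounded : ∀ {a n} → Covers a n → 1 ≤ n →
                   Σ ℕ λ n' → 1 ≤ n' × n' ≤ bound × Covers a n' × walk a n' ≡ walk a n
  covers-bounded {a} {n} = go n (<-wellFounded n)
    where
    go : ∀ n → Acc _<_ n → Covers a n → 1 ≤ n →
         Σ ℕ λ n' → 1 ≤ n' × n' ≤ bound × Covers a n' × walk a n' ≡ walk a n
    go n (acc smaller) cov 1≤n with n ≤? bound
    ... | yes n≤bound = n , 1≤n , n≤bound , cov , refl
    ... | no n≰bound =
      let (n' , n'<n , 1≤n' , cov' , same) = shorten cov (≰⇒> n≰bound)
          (n'' , 1≤n'' , n''≤ , cov'' , same') = go n' (smaller n'<n) cov' 1≤n'
      in n'' , 1≤n'' , n''≤ , cov'' , trans same' same

  record Period (a : Loc) (q : ℕ) : Set where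
    field
      positive : 1 ≤ q
      returns  : walk a q ≡ a
      least    : ∀ {k} → k < q → 1 ≤ k → walk a k ≢ a

    reduce : ∀ t → Σ ℕ λ k → k < q × walk a t ≡ walk a k
    reduce zero = 0 , positive , refl
    reduce (suc t) with reduce t
    ... | k , k<q , e with m≤n⇒m<n∨m≡n k<q
    ...   | inj₁ 1+k<q = suc k , 1+k<q , cong next e
    ...   | inj₂ 1+k≡q = 0 , positive , trans (cong next e) (trans (cong (walk a) 1+k≡q) returns)

    private
      distinct : ∀ {u v} → u < v → v < q → walk a u ≢ walk a v
      distinct {u} {v} u<v v<q e =
        let (d , q≡) = split-≤ (<⇒≤ v<q)
        in least (subst (d + u <_) (sym q≡) (+-monoʳ-< d u<v))
                 (≤-trans (+-cancelʳ-≤ v 1 d (subst (suc v ≤_) q≡ v<q)) (m≤m+n d u))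
                 (trans (walk-shift a d e) (trans (cong (walk a) (sym q≡)) returns))

    injective : ∀ {u v} → u < q → v < q → walk a u ≡ walk a v → u ≡ v
    injective {u} {v} u<q v<q e with <-cmp u v
    ... | tri< u<v _ _ = ⊥-elim (distinct u<v v<q e)
    ... | tri≈ _ u≡v _ = u≡v
    ... | tri> _ _ v<u = ⊥-elim (distinct v<u u<q (sym e))

  period : ∀ {a p} → 1 ≤ p → walk a p ≡ a → Σ ℕ λ q → Period a q × q ≤ p
  period {a} 1≤p back =
    let (q , (1≤q , back′) , q≤p , least) = least-witness (λ k → (1 ≤? k) ×-dec (walk a k ≟ a)) (1≤p , back)
    in q , record { positive = 1≤q ; returns = back′ ; least = λ k<q 1≤k e → least k<q (1≤k , e) } , q≤p

Covers-resp-≗ʰ : ∀ {C C' a n} → C ≗ʰ C' → Walks.Covers C a n → Walks.Covers C' a n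
Covers-resp-≗ʰ {C} {C'} {a} eq (inDom , onWalk) =
  (λ {t} t< → let (v , e) = inDom {t} t< in v , subst (λ z → fun C' z ≡ just v) (same t) (proj₁ eq _ v e)) ,
  (λ (v , e) → let (t , t< , w) = onWalk (v , proj₂ eq _ v e) in t , t< , trans (sym (same t)) w)
  where
  same : ∀ t → Walks.walk C a t ≡ Walks.walk C' a t
  same zero = refl
  same (suc t) rewrite same t = cong (fromMaybe 0) (≗ʰ⇒fun-≡ {C} {C'} eq (Walks.walk C' a t))

-- Sub-heaps and chunks

module WithFiniteStack (s : Stack) (vars : List Var)
                       (vars-complete : ∀ {x l} → s x ≡ just l → x ∈ vars) where

  img? : Decidable (imgS s)
  img? l = ∃?-within vars vars-complete (λ x → ≡-decᴹ _≟_ (s x) (just l))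

  Adjacent : Heap → Loc → Loc → Set
  Adjacent H m u = u ≡ m ⊎ fun H m ≡ just u

  record Linked (H : Heap) (m m' : Loc) : Set where
    constructor linked
    field
      shared     : Loc
      adjacent   : Adjacent H m shared
      adjacent′  : Adjacent H m' shared
      unlabelled : ¬ imgS s shared

  linked-sym : ∀ {H m m'} → Linked H m m' → Linked H m' m
  linked-sym (linked u a a′ ¬i) = linked u a′ a ¬i

  adjacent⇒candidate : ∀ {H m u} → Adjacent H m u → u ∈ m ∷ maybeToList (fun H m)
  adjacent⇒candidate (inj₁ refl) = here refl
  adjacent⇒candidate {H} {m} (inj₂ e) rewrite e = there (here refl)

  linked? : ∀ H m m' → Dec (Linked H m m')
  linked? H m m' =
    map′ (λ (u , a , a′ , ¬i) → linked u a a′ ¬i) (λ (linked u a a′ ¬i) → u , a , a′ , ¬i)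
      (∃?-within (m ∷ maybeToList (fun H m)) (adjacent⇒candidate {H} ∘ proj₁)
        (λ u → adjacent? m u ×-dec adjacent? m' u ×-dec ¬? (img? u)))
    where
    adjacent? : ∀ m u → Dec (Adjacent H m u)
    adjacent? m u = (u ≟ m) ⊎-dec ≡-decᴹ _≟_ (fun H m) (just u)

  record Closed (H : Heap) (P : Loc → Set) : Set where
    constructor mkClosed
    field
      apart : ∀ {m m'} → domH H m → domH H m' → P m → ¬ P m' → ¬ Linked H m m'
  open Closed public

  Closed-resp : ∀ {H P Q} → Closed H P → (∀ {m} → domH H m → P m → Q m) → (∀ {m} → domH H m → Q m → P m) →
                Closed H Q
  Closed-resp c P⇒Q Q⇒P = mkClosed λ dm dm' qm ¬qm' →
    apart c dm dm' (Q⇒P dm qm) (¬qm' ∘ P⇒Q dm')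

  Closed-∁ : ∀ {H P} → Decidable P → Closed H P → Closed H (λ m → ¬ P m)
  Closed-∁ P? c = mkClosed λ dm dm' ¬pm ¬¬pm' lk →
    apart c dm' dm (decidable-stable (P? _) ¬¬pm') ¬pm (linked-sym lk)

  Closed-∩ : ∀ {H P Q} → Decidable P → Closed H P → Closed H Q → Closed H (λ m → P m × Q m)
  Closed-∩ {H} {P} {Q} P? c d = mkClosed apart∩
    where
    apart∩ : ∀ {m m'} → domH H m → domH H m' → P m × Q m → ¬ (P m' × Q m') → ¬ Linked H m m'
    apart∩ {m' = m'} dm dm' (pm , qm) ¬pqm' with P? m'
    ... | yes pm' = apart d dm dm' qm (¬pqm' ∘ (pm' ,_))
    ... | no ¬pm' = apart c dm dm' pm ¬pm'

  subHeap⇒⊆ʰ : ∀ {T H} → SubHeap s T H → T ⊆ʰ H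
  subHeap⇒⊆ʰ (_ , _ , _ , graph) l v e = proj₂ (graph l v) (inj₁ e)

  subHeap⇒closed : ∀ {T H} → SubHeap s T H → Closed H (domH T)
  subHeap⇒closed {T} {H} sub@(U , _ , shared , graph) = mkClosed λ dm dm' tm ¬tm' (linked u a a′ ¬i) →
    ¬i (shared u (locsT tm a) (locsU dm' ¬tm' a′))
    where
    locsT : ∀ {m u} → domH T m → Adjacent H m u → locs T u
    locsT dm (inj₁ refl) = inj₁ dm
    locsT dm (inj₂ e) = inj₂ (_ , ⊆ʰ-agrees {T} {H} (subHeap⇒⊆ʰ {T} {H} sub) dm e)
    inU : ∀ {m v} → ¬ domH T m → fun H m ≡ just v → fun U m ≡ just v
    inU {m} {v} ¬t e with proj₁ (graph m v) e
    ... | inj₁ f = ⊥-elim (¬t (v , f))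
    ... | inj₂ f = f
    locsU : ∀ {m u} → domH H m → ¬ domH T m → Adjacent H m u → locs U u
    locsU (v , e) ¬t (inj₁ refl) = inj₁ (v , inU ¬t e)
    locsU _ ¬t (inj₂ e) = inj₂ (_ , inU ¬t e)

  restrict-sepUnion : ∀ {H P Q} (P? : Decidable P) (Q? : Decidable Q) → Closed H P →
                      (∀ {l} → P l → ¬ Q l) → (∀ {l} → domH H l → ¬ P l → Q l) →
                      SepUnion s H (restrict H P?) (restrict H Q?)
  restrict-sepUnion {H} {P} {Q} P? Q? c P⇒¬Q ¬P⇒Q = disjoint , shared , graph
    where
    disjoint : ∀ l → domH (restrict H P?) l → domH (restrict H Q?) l → ⊥
    disjoint l (_ , e) (_ , e') = P⇒¬Q (restrict-sat H P? e) (restrict-sat H Q? e')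
    cell : ∀ {X} (X? : Decidable X) {u} → locs (restrict H X?) u →
           Σ Loc λ m → domH H m × X m × Adjacent H m u
    cell X? (inj₁ (v , e)) = _ , (v , restrict-⊆ʰ H X? _ v e) , restrict-sat H X? e , inj₁ refl
    cell X? (inj₂ (m , e)) = m , (_ , restrict-⊆ʰ H X? m _ e) , restrict-sat H X? e , inj₂ (restrict-⊆ʰ H X? m _ e)
    shared : ∀ u → locs (restrict H P?) u → locs (restrict H Q?) u → imgS s u
    shared u l₁ l₂ with img? u
    ... | yes i = i
    ... | no ¬i = let (m , dm , pm , a) = cell P? l₁ ; (m' , dm' , qm' , a′) = cell Q? l₂
                  in ⊥-elim (apart c dm dm' pm (λ pm' → P⇒¬Q pm' qm') (linked u a a′ ¬i))
    graph : ∀ l v → fun H l ≡ just v ⇔ (fun (restrict H P?) l ≡ just v ⊎ fun (restrict H Q?) l ≡ just v)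
    graph l v = split , [ restrict-⊆ʰ H P? l v , restrict-⊆ʰ H Q? l v ]′
      where
      split : fun H l ≡ just v → fun (restrict H P?) l ≡ just v ⊎ fun (restrict H Q?) l ≡ just v
      split e with P? l
      ... | yes _ = inj₁ e
      ... | no ¬p = inj₂ (restrict-keeps H Q? (¬P⇒Q (v , e) ¬p) e)

  SepUnion-resp-≗ʰ : ∀ {H T T' U} → T ≗ʰ T' → SepUnion s H T U → SepUnion s H T' U
  SepUnion-resp-≗ʰ {H} {T} {T'} {U} (T⊆ , T'⊆) (disjoint , shared , graph) =
    (λ l (v , e) → disjoint l (v , T'⊆ l v e)) ,
    (λ u → shared u ∘ locs-back) ,
    λ l v → [ inj₁ ∘ T⊆ l v , inj₂ ]′ ∘ proj₁ (graph l v) ,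
            proj₂ (graph l v) ∘ [ inj₁ ∘ T'⊆ l v , inj₂ ]′
    where
    locs-back : ∀ {u} → locs T' u → locs T u
    locs-back (inj₁ (v , e)) = inj₁ (v , T'⊆ _ v e)
    locs-back (inj₂ (l , e)) = inj₂ (l , T'⊆ l _ e)

  ⊆ʰ⇒≗ʰ-restrict : ∀ {T H} → T ⊆ʰ H → T ≗ʰ restrict H (dom? T)
  ⊆ʰ⇒≗ʰ-restrict {T} {H} T⊆ =
    (λ l v e → restrict-keeps H (dom? T) (v , e) (T⊆ l v e)) ,
    (λ l v e → ⊆ʰ-agrees {T} {H} T⊆ (restrict-sat H (dom? T) e) (restrict-⊆ʰ H (dom? T) l v e))

  closed⇒subHeap : ∀ {T H} → T ⊆ʰ H → Closed H (domH T) → SubHeap s T H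
  closed⇒subHeap {T} {H} T⊆ c = restrict H (¬? ∘ dom? T) ,
    SepUnion-resp-≗ʰ {H} {restrict H (dom? T)} {T} {restrict H (¬? ∘ dom? T)}
      (≗ʰ-sym {T} {restrict H (dom? T)} (⊆ʰ⇒≗ʰ-restrict {T} {H} T⊆))
      (restrict-sepUnion (dom? T) (¬? ∘ dom? T) c (λ t ¬t → ¬t t) (λ _ → id))

  Chunk-resp-≗ʰ : ∀ {H C C'} → C ≗ʰ C' → Chunk s H C → Chunk s H C'
  Chunk-resp-≗ʰ {H} {C} {C'} (C⊆ , C'⊆) (sub , (l , v , e) , minimal) =
    closed⇒subHeap {C'} {H} (⊆ʰ-trans {C'} {C} {H} C'⊆ (subHeap⇒⊆ʰ {C} {H} sub))
      (Closed-resp (subHeap⇒closed {C} {H} sub) (λ _ (v , e) → v , C⊆ _ v e) (λ _ (v , e) → v , C'⊆ _ v e)) ,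
    (l , v , C⊆ l v e) ,
    λ T sT (neT , T⊆ , ¬⊇) →
      minimal T sT (neT , ⊆ʰ-trans {T} {C'} {C} T⊆ C'⊆ , ¬⊇ ∘ ⊆ʰ-trans {C'} {C} {T} C'⊆)

  NegChunk-resp-≗ʰ : ∀ {H C C'} → C ≗ʰ C' → NegChunk s H C → NegChunk s H C'
  NegChunk-resp-≗ʰ {H} {C} {C'} eq (ch , ¬sat) =
    Chunk-resp-≗ʰ {H} {C} {C'} eq ch , λ (τ , sat) → ¬sat (τ , ⊨-resp-≗ʰ τ (≗ʰ-sym {C} {C'} eq) sat)

  module Restriction {H P} (P? : Decidable P) (P-closed : Closed H P) where

    H↾P : Heap
    H↾P = restrict H P?

    linked-restrict⁻ : ∀ {m m'} → Linked H↾P m m' → Linked H m m'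
    linked-restrict⁻ (linked u a a′ ¬i) = linked u (widen a) (widen a′) ¬i
      where
      widen : ∀ {m} → Adjacent H↾P m u → Adjacent H m u
      widen (inj₁ e) = inj₁ e
      widen (inj₂ e) = inj₂ (restrict-⊆ʰ H P? _ u e)

    linked-restrict⁺ : ∀ {m m'} → P m → P m' → Linked H m m' → Linked H↾P m m'
    linked-restrict⁺ pm pm' (linked u a a′ ¬i) = linked u (narrow pm a) (narrow pm' a′) ¬i
      where
      narrow : ∀ {m} → P m → Adjacent H m u → Adjacent H↾P m u
      narrow _ (inj₁ e) = inj₁ e
      narrow p (inj₂ e) = inj₂ (restrict-keeps H P? p e)

    subHeap-restrict⁻ : ∀ {T} → SubHeap s T H↾P → SubHeap s T H
    subHeap-restrict⁻ {T} sub =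
      closed⇒subHeap {T} {H} (⊆ʰ-trans {T} {H↾P} {H} T⊆ (restrict-⊆ʰ H P?)) (mkClosed apart′)
      where
      T⊆ : T ⊆ʰ H↾P
      T⊆ = subHeap⇒⊆ʰ {T} {H↾P} sub
      apart′ : ∀ {m m'} → domH H m → domH H m' → domH T m → ¬ domH T m' → ¬ Linked H m m'
      apart′ {m' = m'} dm (v' , e') (v , e) ¬tm' lk with P? m'
      ... | yes pm' = apart (subHeap⇒closed {T} {H↾P} sub) (v , T⊆ _ v e) (v' , restrict-keeps H P? pm' e')
                        (v , e) ¬tm' (linked-restrict⁺ (restrict-sat H P? (T⊆ _ v e)) pm' lk)
      ... | no ¬pm' = apart P-closed dm (v' , e') (restrict-sat H P? (T⊆ _ v e)) ¬pm' lk

    subHeap-restrict⁺ : ∀ {T} → SubHeap s T H → T ⊆ʰ H↾P → SubHeap s T H↾P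
    subHeap-restrict⁺ {T} sub T⊆ = closed⇒subHeap {T} {H↾P} T⊆ (mkClosed λ (v , e) (v' , e') tm ¬tm' lk →
      apart (subHeap⇒closed {T} {H} sub) (v , restrict-⊆ʰ H P? _ v e) (v' , restrict-⊆ʰ H P? _ v' e') tm ¬tm'
        (linked-restrict⁻ lk))

    chunk-restrict⁻ : ∀ {C} → Chunk s H↾P C → Chunk s H C × C ⊆ʰ H↾P
    chunk-restrict⁻ {C} (sub , ne , minimal) =
      (subHeap-restrict⁻ {C} sub , ne , λ T sT (neT , T⊆ , ¬⊇) →
        minimal T (subHeap-restrict⁺ {T} sT (⊆ʰ-trans {T} {C} {H↾P} T⊆ C⊆)) (neT , T⊆ , ¬⊇)) , C⊆
      where
      C⊆ : C ⊆ʰ H↾P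
      C⊆ = subHeap⇒⊆ʰ {C} {H↾P} sub

    chunk-restrict⁺ : ∀ {C} → Chunk s H C → C ⊆ʰ H↾P → Chunk s H↾P C
    chunk-restrict⁺ {C} (sub , ne , minimal) C⊆ =
      subHeap-restrict⁺ {C} sub C⊆ , ne , λ T → minimal T ∘ subHeap-restrict⁻ {T}

  module Components (h : Heap) where

    domList : List Loc
    domList = filter (dom? h) (proj₁ (finite h))

    dom⇒∈domList : ∀ {l} → domH h l → l ∈ domList
    dom⇒∈domList {l} (v , e) = ∈-filter⁺ (dom? h) (proj₂ (finite h) l v e) (v , e)

    ∈domList⇒dom : ∀ {l} → l ∈ domList → domH h l
    ∈domList⇒dom = proj₂ ∘ ∈-filter⁻ (dom? h) {xs = proj₁ (finite h)}

    ClosedList : List Loc → Set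
    ClosedList S = All (λ m → All (λ m' → m' ∈ S ⊎ ¬ Linked h m m') domList) S

    closedList? : Decidable ClosedList
    closedList? S = all? (λ m → all? (λ m' → (m' ∈? S) ⊎-dec ¬? (linked? h m m')) domList) S

    -- m lies in every closed set of cells containing l; closed sets are ranged over as sublists of
    -- the domain, which keeps this decidable.
    Connected : Loc → Loc → Set
    Connected l m = All (λ S → ClosedList S → l ∈ S → m ∈ S) (sublists domList)

    connected? : ∀ l → Decidable (Connected l)
    connected? l m = all? (λ S → closedList? S →-dec ((l ∈? S) →-dec (m ∈? S))) (sublists domList)

    connected-refl : ∀ {l} → Connected l l
    connected-refl = All.tabulate λ _ _ → id

    connected-least : ∀ {P l m} → Decidable P → Closed h P → domH h l → P l → Connected l m → P m
    connected-least {P} {l} {m} P? c dl pl l~m =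
      proj₂ (∈-filter⁻ P? {xs = domList}
        (All.lookup l~m (filter∈sublists P? domList) closedS (∈-filter⁺ P? (dom⇒∈domList dl) pl)))
      where
      S : List Loc
      S = filter P? domList
      inS-or-apart : ∀ {m m'} → m ∈ S → m' ∈ domList → m' ∈ S ⊎ ¬ Linked h m m'
      inS-or-apart {m' = m'} m∈S m'∈D with P? m'
      ... | yes pm' = inj₁ (∈-filter⁺ P? m'∈D pm')
      ... | no ¬pm' = let (m∈D , pm) = ∈-filter⁻ P? {xs = domList} m∈S in
                      inj₂ (apart c (∈domList⇒dom m∈D) (∈domList⇒dom m'∈D) pm ¬pm')
      closedS : ClosedList S
      closedS = All.tabulate λ m∈S → All.tabulate (inS-or-apart m∈S)

    connected-closed : ∀ l → Closed h (Connected l)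
    connected-closed l = mkClosed λ {m} {m'} dm dm' l~m l≁m' lk →
      let (S , S∈ , ¬l~m'ˢ) = find (¬All⇒Any¬ (λ S → closedList? S →-dec ((l ∈? S) →-dec (m' ∈? S))) _ l≁m')
          (closedS , ¬imp) = ¬→⇒×¬ (closedList? S) ¬l~m'ˢ
          (l∈S , m'∉S) = ¬→⇒×¬ (l ∈? S) ¬imp
          m∈S = All.lookup l~m S∈ closedS l∈S
      in [ m'∉S , (λ ¬lk → ¬lk lk) ]′ (All.lookup (All.lookup closedS m∈S) (dom⇒∈domList dm'))

    connected-trans : ∀ {l m z} → domH h m → Connected l m → Connected m z → Connected l z
    connected-trans {l} dm = connected-least (connected? l) (connected-closed l) dm

    connected-sym : ∀ {l m} → domH h l → Connected l m → Connected m l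
    connected-sym {l} {m} dl l~m = decidable-stable (connected? m l) λ m≁l →
      proj₂ (connected-least {λ z → Connected l z × ¬ Connected m z} (λ z → connected? l z ×-dec ¬? (connected? m z))
               (Closed-∩ (connected? l) (connected-closed l) (Closed-∁ (connected? m) (connected-closed m)))
               dl (connected-refl , m≁l) l~m)
            connected-refl

    component : Loc → Heap
    component l = restrict h (connected? l)

    component-subHeap : ∀ l → SubHeap s (component l) h
    component-subHeap l = closed⇒subHeap {component l} {h} (restrict-⊆ʰ h (connected? l))
      (Closed-resp (connected-closed l) (λ (v , e) l~m → v , restrict-keeps h (connected? l) l~m e)
                                        (λ _ (v , e) → restrict-sat h (connected? l) e))

    component-chunk : ∀ {l} → domH h l → Chunk s h (component l)
    component-chunk {l} (v , e) = component-subHeap l , (l , v , restrict-keeps h (connected? l) connected-refl e) , minimal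
      where
      minimal : ∀ T → SubHeap s T h → ¬ (NonEmptyH T × T ⊊ʰ component l)
      minimal T sT ((m₀ , w₀ , e₀) , T⊆ , ¬⊇) with dom? T l
      ... | yes tl = ¬⊇ λ z v' f →
        let (w , g) = connected-least (dom? T) (subHeap⇒closed {T} {h} sT) (v , e) tl (restrict-sat h (connected? l) f)
        in ⊆ʰ-agrees {T} {h} (subHeap⇒⊆ʰ {T} {h} sT) (w , g) (restrict-⊆ʰ h (connected? l) z v' f)
      ... | no ¬tl = proj₂ (connected-least {λ z → Connected l z × ¬ domH T z}
                       (λ z → connected? l z ×-dec ¬? (dom? T z))
                       (Closed-∩ (connected? l) (connected-closed l) (Closed-∁ (dom? T) (subHeap⇒closed {T} {h} sT)))
                       (v , e) (connected-refl , ¬tl) (restrict-sat h (connected? l) (T⊆ m₀ w₀ e₀)))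
                     (w₀ , e₀)

    chunk≗ʰcomponent : ∀ {C l} → Chunk s h C → domH C l → C ≗ʰ component l
    chunk≗ʰcomponent {C} {l} ch@(sub , _ , minimal) (v , e) = C⊆comp , comp⊆C
      where
      C⊆h : C ⊆ʰ h
      C⊆h = subHeap⇒⊆ʰ {C} {h} sub
      comp⊆C : component l ⊆ʰ C
      comp⊆C z v' f =
        ⊆ʰ-agrees {C} {h} C⊆h
          (connected-least (dom? C) (subHeap⇒closed {C} {h} sub) (v , C⊆h l v e) (v , e) (restrict-sat h (connected? l) f))
          (restrict-⊆ʰ h (connected? l) z v' f)
      C⊆comp : C ⊆ʰ component l
      C⊆comp z v' f with connected? l z
      ... | yes _ = C⊆h z v' f
      ... | no l≁z = ⊥-elim (minimal (component l) (component-subHeap l)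
                       ((l , v , restrict-keeps h (connected? l) connected-refl (C⊆h l v e)) , comp⊆C ,
                        λ C⊆ → l≁z (restrict-sat h (connected? l) (C⊆ z v' f))))

    -- A canonical name for the chunk containing l, so that the side of a cell depends only on its chunk.
    representative : Loc → Loc
    representative l = fromMaybe l (findFirst (connected? l) domList)

    representative-connected : ∀ {l} → domH h l → Connected l (representative l) × domH h (representative l)
    representative-connected {l} dl with findFirst-complete (connected? l) (dom⇒∈domList dl) connected-refl
    ... | z , e rewrite e = let (l~z , z∈D) = findFirst-sound (connected? l) domList e in l~z , ∈domList⇒dom z∈D

    representative-cong : ∀ {l m} → domH h l → domH h m → Connected l m → representative l ≡ representative m
    representative-cong {l} {m} dl dm l~m =
      let (z , e) = findFirst-complete (connected? l) (dom⇒∈domList dl) connected-refl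
          same = findFirst-cong (connected? l) (connected? m)
                   (connected-trans dl (connected-sym dl l~m)) (connected-trans dm l~m) domList
      in trans (cong (fromMaybe l) e) (sym (cong (fromMaybe m) (trans (sym same) e)))

    chunk-connected : ∀ {C P a m} → Chunk s h C → Decidable P → Closed h P → domH C a → P a → domH C m → P m
    chunk-connected {C} {P} {a} {m} ch P? c (v , e) pa (w , f) =
      connected-least P? c (v , subHeap⇒⊆ʰ {C} {h} (proj₁ ch) a v e) pa
        (restrict-sat h (connected? a) (proj₁ (chunk≗ʰcomponent {C} ch (v , e)) m w f))

    -- If the walks from two distinct labelled locations a and b both cover a chunk, then the walk
    -- from a is a cycle through b, and its arc from a up to b is separated from the rest of h:
    -- the arc can only be left through a or b, which are labelled.
    module TwoStarts {C} (ch : Chunk s h C) {a b n n'}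
                     (covA : Walks.Covers C a n) (covB : Walks.Covers C b n') (1≤n : 1 ≤ n) (1≤n' : 1 ≤ n')
                     (ia : imgS s a) (ib : imgS s b) (a≢b : a ≢ b) where

      open Walks C

      b-on-a : Σ ℕ λ j → j < n × walk a j ≡ b
      b-on-a = proj₂ covA (proj₁ covB 1≤n')

      a-on-b : Σ ℕ λ t → t < n' × walk b t ≡ a
      a-on-b = proj₂ covB (proj₁ covA 1≤n)

      j₀ t₀ : ℕ
      j₀ = proj₁ b-on-a
      t₀ = proj₁ a-on-b

      cycle : walk a (t₀ + j₀) ≡ a
      cycle = trans (walk-+ a j₀ t₀)
                (trans (cong (λ z → walk z t₀) (proj₂ (proj₂ b-on-a))) (proj₂ (proj₂ a-on-b)))

      positive-index : ∀ {j} → walk a j ≡ b → 1 ≤ j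
      positive-index {zero} e = ⊥-elim (a≢b e)
      positive-index {suc _} _ = s≤s z≤n

      cycle-in-dom : ∀ {t} → t < t₀ + j₀ → domH C (walk a t)
      cycle-in-dom {t} t< with t <? j₀
      ... | yes t<j₀ = proj₁ covA (<-trans t<j₀ (proj₁ (proj₂ b-on-a)))
      ... | no t≮j₀ =
        let (u , t≡) = split-≤ (≮⇒≥ t≮j₀)
        in subst (domH C)
             (sym (trans (cong (walk a) t≡) (trans (walk-+ a j₀ u) (cong (λ z → walk z u) (proj₂ (proj₂ b-on-a))))))
             (proj₁ covB (<-trans (+-cancelʳ-< j₀ u t₀ (subst (_< t₀ + j₀) t≡ t<)) (proj₁ (proj₂ a-on-b))))

      cycle-period : Σ ℕ λ q → Period a q × q ≤ t₀ + j₀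
      cycle-period = period (≤-trans (positive-index (proj₂ (proj₂ b-on-a))) (m≤n+m j₀ t₀)) cycle

      q : ℕ
      q = proj₁ cycle-period

      open Period (proj₁ (proj₂ cycle-period))

      orbit-in-dom : ∀ t → domH C (walk a t)
      orbit-in-dom t = let (k , k<q , e) = reduce t in
        subst (domH C) (sym e) (cycle-in-dom (<-≤-trans k<q (proj₂ (proj₂ cycle-period))))

      on-orbit : ∀ {m} → domH C m → Σ ℕ λ k → k < q × walk a k ≡ m
      on-orbit dm = let (t , _ , e) = proj₂ covA dm ; (k , k<q , e') = reduce t in k , k<q , trans (sym e') e

      j : ℕ
      j = proj₁ (reduce j₀)

      j<q : j < q
      j<q = proj₁ (proj₂ (reduce j₀))

      walk-j : walk a j ≡ b
      walk-j = trans (sym (proj₂ (proj₂ (reduce j₀)))) (proj₂ (proj₂ b-on-a))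

      BeforeB : Loc → Set
      BeforeB m = Σ ℕ λ t → t < j × walk a t ≡ m

      beforeB? : Decidable BeforeB
      beforeB? m = anyUpTo? (λ t → walk a t ≟ m) j

      adjacent-on-orbit : ∀ k {u} → Adjacent h (walk a k) u → u ≡ walk a k ⊎ u ≡ walk a (suc k)
      adjacent-on-orbit k (inj₁ e) = inj₁ e
      adjacent-on-orbit k (inj₂ e) =
        inj₂ (sym (next-≡ (⊆ʰ-agrees {C} {h} (subHeap⇒⊆ʰ {C} {h} (proj₁ ch)) (orbit-in-dom k) e)))

      unlabelled-inside : ∀ {x} → x ≤ j → ¬ imgS s (walk a x) → 1 ≤ x × x < j
      unlabelled-inside {zero} _ ¬i = ⊥-elim (¬i ia)
      unlabelled-inside {suc x} x≤j ¬i with m≤n⇒m<n∨m≡n x≤j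
      ... | inj₁ x<j = s≤s z≤n , x<j
      ... | inj₂ x≡j = ⊥-elim (¬i (subst (imgS s) (sym (trans (cong (walk a) x≡j) walk-j)) ib))

      leaves-through : ∀ {x k} → 1 ≤ x → x < j → k < q →
                       walk a x ≡ walk a k ⊎ walk a x ≡ walk a (suc k) → k < j
      leaves-through _ x<j k<q (inj₁ e) = subst (_< j) (injective (<-trans x<j j<q) k<q e) x<j
      leaves-through (s≤s z≤n) x<j k<q (inj₂ e) with m≤n⇒m<n∨m≡n k<q
      ... | inj₁ 1+k<q = <-trans (n<1+n _) (subst (_< j) (injective (<-trans x<j j<q) 1+k<q e) x<j)
      ... | inj₂ 1+k≡q =
        contradiction (injective (<-trans x<j j<q) positive (trans e (trans (cong (walk a) 1+k≡q) returns))) λ ()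

      arc-index : ∀ {i u} → i < j → u ≡ walk a i ⊎ u ≡ walk a (suc i) → Σ ℕ λ x → x ≤ j × u ≡ walk a x
      arc-index {i} i<j (inj₁ e) = i , <⇒≤ i<j , e
      arc-index {i} i<j (inj₂ e) = suc i , i<j , e

      in-chunk : ∀ {m m'} → domH C m → domH h m' → Linked h m m' → domH C m'
      in-chunk {m} {m'} (v , e) dm' lk = decidable-stable (dom? C m') λ ¬dm' →
        apart (subHeap⇒closed {C} {h} (proj₁ ch)) (v , subHeap⇒⊆ʰ {C} {h} (proj₁ ch) m v e) dm' (v , e) ¬dm' lk

      beforeB-closed : Closed h BeforeB
      beforeB-closed = mkClosed λ {m} {m'} _ dm' (i , i<j , wi) m'∉ lk →
        let open Linked lk
            (k , k<q , wk) = on-orbit (in-chunk (subst (domH C) wi (orbit-in-dom i)) dm' lk)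
            (x , x≤j , ux) = arc-index i<j (adjacent-on-orbit i (subst (λ z → Adjacent h z shared) (sym wi) adjacent))
            (1≤x , x<j) = unlabelled-inside x≤j (subst (λ z → ¬ imgS s z) ux unlabelled)
            u-at-k = Data.Sum.map (trans (sym ux)) (trans (sym ux))
                       (adjacent-on-orbit k (subst (λ z → Adjacent h z shared) (sym wk) adjacent′))
        in m'∉ (k , leaves-through 1≤x x<j k<q u-at-k , wk)

      absurd : ⊥
      absurd =
        let (t , t<j , wt) = chunk-connected {C} {BeforeB} ch beforeB? beforeB-closed (proj₁ covA 1≤n)
                               (0 , positive-index walk-j , refl) (proj₁ covB 1≤n')
        in <⇒≢ t<j (injective (<-trans t<j j<q) j<q (trans wt (sym walk-j)))

    chunk-start-unique : ∀ {C} → Chunk s h C → ∀ {a b n n'} → Walks.Covers C a n → Walks.Covers C b n' →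
                         1 ≤ n → 1 ≤ n' → imgS s a → imgS s b → a ≡ b
    chunk-start-unique ch {a} {b} covA covB 1≤n 1≤n' ia ib with a ≟ b
    ... | yes a≡b = a≡b
    ... | no a≢b = ⊥-elim (TwoStarts.absurd ch covA covB 1≤n 1≤n' ia ib a≢b)

    linked⇒connected : ∀ {m m'} → domH h m → domH h m' → Linked h m m' → Connected m m'
    linked⇒connected {m} {m'} dm dm' lk =
      decidable-stable (connected? m m') λ m≁m' → apart (connected-closed m) dm dm' connected-refl m≁m' lk

    chunk≗ʰrepresentative : ∀ {C l} → Chunk s h C → domH C l → C ≗ʰ component (representative l)
    chunk≗ʰrepresentative {C} {l} ch (v , e) =
      let dl = (v , subHeap⇒⊆ʰ {C} {h} (proj₁ ch) l v e)
          (l~r , dr) = representative-connected dl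
      in ≗ʰ-trans {C} {component l} {component (representative l)} (chunk≗ʰcomponent {C} ch (v , e))
           (restrict-cong h (connected? l) (connected? (representative l))
              (λ _ → connected-trans dl (connected-sym dl l~r)) (λ _ → connected-trans dr l~r))

    representative-in-dom : ∀ {C l} → Chunk s h C → domH C l → domH h (representative l)
    representative-in-dom {C} {l} ch (v , e) =
      proj₂ (representative-connected (v , subHeap⇒⊆ʰ {C} {h} (proj₁ ch) l v e))

  SegmentStart : Heap → Var → Set
  SegmentStart C x = Σ Loc λ a → s x ≡ just a × Σ ℕ λ n → 1 ≤ n × Walks.Covers C a n

  ChunkEdge : Heap → Edge → Set
  ChunkEdge C (B , B' , l) = Σ Var λ x → Σ Var λ y → domS s x × domS s y × (B ≐ cl s x) × (B' ≐ cl s y) ×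
    (((l ≡ one) × (s , C ⊨ (x ↦ y))) ⊎ ((l ≡ ge2) × (s , C ⊨ ls x y) × ¬ (s , C ⊨ (x ↦ y))))

  Eabs⇒chunkEdge : ∀ {H e} → Eabs s H e → Σ Heap λ C → PosChunk s H C × ChunkEdge C e
  Eabs⇒chunkEdge (x , y , dx , dy , Bx , By , inj₁ (l≡ , C , pc , pt)) =
    C , pc , x , y , dx , dy , Bx , By , inj₁ (l≡ , pt)
  Eabs⇒chunkEdge (x , y , dx , dy , Bx , By , inj₂ (l≡ , C , pc , sat , ¬pt)) =
    C , pc , x , y , dx , dy , Bx , By , inj₂ (l≡ , sat , ¬pt)

  chunkEdge⇒Eabs : ∀ {H C e} → PosChunk s H C → ChunkEdge C e → Eabs s H e
  chunkEdge⇒Eabs {C = C} pc (x , y , dx , dy , Bx , By , inj₁ (l≡ , pt)) =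
    x , y , dx , dy , Bx , By , inj₁ (l≡ , C , pc , pt)
  chunkEdge⇒Eabs {C = C} pc (x , y , dx , dy , Bx , By , inj₂ (l≡ , sat , ¬pt)) =
    x , y , dx , dy , Bx , By , inj₂ (l≡ , C , pc , sat , ¬pt)

  chunkEdge-start : ∀ {C e} → NonEmptyH C → ChunkEdge C e → Σ Var λ x → (proj₁ e ≐ cl s x) × SegmentStart C x
  chunkEdge-start {C} _ (x , _ , _ , _ , Bx , _ , inj₁ (_ , lx , _ , ex , _ , g)) =
    x , Bx , lx , ex , 1 , s≤s z≤n , proj₁ (Walks.pointsTo⇒covers C g)
  chunkEdge-start (l , d) (_ , _ , _ , _ , _ , _ , inj₂ (_ , inj₁ (em , _) , _)) = ⊥-elim (em l d)
  chunkEdge-start {C} _ (x , _ , _ , _ , Bx , _ , inj₂ (_ , inj₂ (ℓ , n , 1≤n , ex , _ , g) , _)) =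
    x , Bx , ℓ 0 , ex , n , 1≤n , proj₁ (Walks.segment⇒covers C g)

  module Segments (C : Heap) where
    open Walks C

    SegmentFrom : Var → Var → ℕ → Set
    SegmentFrom x y n = Σ Loc λ a → s x ≡ just a × Σ Loc λ b → s y ≡ just b × walk a n ≡ b × Covers a n

    -- Bounding the length makes being a nonempty list segment between labelled locations decidable.
    IsSegment : Set
    IsSegment = Σ Var λ x → Σ Var λ y → Σ ℕ λ n → n < suc bound × 1 ≤ n × SegmentFrom x y n

    isSegment? : Dec IsSegment
    isSegment? =
      ∃?-within vars (λ (_ , _ , _ , _ , _ , ex , _) → vars-complete ex) λ x →
      ∃?-within vars (λ (_ , _ , _ , _ , _ , _ , ey , _) → vars-complete ey) λ y →
      anyUpTo? (λ n → (1 ≤? n) ×-dec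
        ∃-just? (s x) (λ a → ∃-just? (s y) (λ b → (walk a n ≟ b) ×-dec covers? a n))) (suc bound)

    atom⇒isSegment : NonEmptyH C → (τ : Atom) → s , C ⊨ τ → IsSegment
    atom⇒isSegment (l , d) emp em = ⊥-elim (em l d)
    atom⇒isSegment _ (x ↦ y) (lx , ly , ex , ey , g) =
      let (cov , w) = pointsTo⇒covers g in x , y , 1 , s≤s (s≤s z≤n) , s≤s z≤n , lx , ex , ly , ey , w , cov
    atom⇒isSegment (l , d) (ls x y) (inj₁ (em , _)) = ⊥-elim (em l d)
    atom⇒isSegment _ (ls x y) (inj₂ (ℓ , n , 1≤n , ex , ey , g)) =
      let (cov , w) = segment⇒covers g
          (n' , 1≤n' , n'≤ , cov' , w') = covers-bounded cov 1≤n
      in x , y , n' , s≤s n'≤ , 1≤n' , ℓ 0 , ex , ℓ n , ey , trans w' w , cov'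
    atom⇒isSegment (l , d) (x ≐v y) (em , _) = ⊥-elim (em l d)
    atom⇒isSegment (l , d) (x ≠v y) (em , _) = ⊥-elim (em l d)

    isSegment-start : ((x , _) : IsSegment) → SegmentStart C x
    isSegment-start (_ , _ , n , _ , 1≤n , a , ex , _ , _ , _ , cov) = a , ex , n , 1≤n , cov

    segment⇒ls : ∀ {x y n} → 1 ≤ n → SegmentFrom x y n → s , C ⊨ ls x y
    segment⇒ls {n = n} 1≤n (a , ex , b , ey , w , cov) =
      inj₂ (walk a , n , 1≤n , ex , trans ey (cong just (sym w)) , covers⇒segment cov)

    isSegment⇒atom : IsSegment → Σ Atom λ τ → s , C ⊨ τ
    isSegment⇒atom (x , y , _ , _ , 1≤n , seg) = ls x y , segment⇒ls 1≤n seg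

    segment-edge : ∀ {x y n} → 1 ≤ n → SegmentFrom x y n → Σ Label λ l → ChunkEdge C (cl s x , cl s y , l)
    segment-edge {x} {y} 1≤n seg@(a , ex , b , ey , _ , _) with covers? a 1 ×-dec (walk a 1 ≟ b)
    ... | yes (cov₁ , w₁) = one , x , y , (a , ex) , (b , ey) , ≐-refl , ≐-refl , inj₁ (refl , pt)
      where
      pt : s , C ⊨ (x ↦ y)
      pt = a , b , ex , ey , subst (PointsToGraph a) w₁ (covers⇒pointsTo cov₁)
    ... | no ¬pt₁ = ge2 , x , y , (a , ex) , (b , ey) , ≐-refl , ≐-refl , inj₂ (refl , segment⇒ls 1≤n seg , ¬pt)
      where
      ¬pt : ¬ (s , C ⊨ (x ↦ y))
      ¬pt (lx , ly , ex' , ey' , g) with just-injective (trans (sym ex') ex) | just-injective (trans (sym ey') ey)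
      ... | refl | refl = ¬pt₁ (pointsTo⇒covers g)

  -- Dealing the chunks out to the two sides

  module Split (h : Heap) (A₁ A₂ : AMS) (compat : Compatible A₁ A₂) (abst : Abst s h (A₁ ⊙ A₂)) where
    open Components h
    open Segments using (IsSegment; isSegment?; atom⇒isSegment; isSegment-start; isSegment⇒atom; segment-edge)

    InE : Edge → Set
    InE e = E A₁ e ⊎ E A₂ e

    InR : (Block → Set) → Set
    InR F = R A₁ F ⊎ R A₂ F

    edge-realised : ∀ e → InE e → Σ Edge λ e' → Eabs s h e' × e ≐E e'
    edge-realised = proj₁ (proj₁ (proj₂ abst))

    edge-abstracted : ∀ e' → Eabs s h e' → Σ Edge λ e → InE e × e ≐E e'
    edge-abstracted = proj₂ (proj₁ (proj₂ abst))

    blocks-realised : ∀ F → InR F → Σ (Block → Set) λ F' → Rabs s h F' × F ≋ F'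
    blocks-realised = proj₁ (proj₁ (proj₂ (proj₂ abst)))

    blocks-abstracted : ∀ F' → Rabs s h F' → Σ (Block → Set) λ F → InR F × F ≋ F'
    blocks-abstracted = proj₂ (proj₁ (proj₂ (proj₂ abst)))

    k : ℕ
    k = proj₁ (proj₂ (proj₂ (proj₂ abst)))

    r : ℕ
    r = proj₁ (proj₂ (proj₂ (proj₂ (proj₂ abst))))

    negChunks : HasSize _≗ʰ_ (NegChunk s h) k
    negChunks = proj₁ (proj₂ (proj₂ (proj₂ (proj₂ (proj₂ abst)))))

    blocks : HasSize _≋_ (Rabs s h) r
    blocks = proj₁ (proj₂ (proj₂ (proj₂ (proj₂ (proj₂ (proj₂ abst))))))

    γ-sum : γ A₁ + γ A₂ ≡ k ∸ r
    γ-sum = proj₂ (proj₂ (proj₂ (proj₂ (proj₂ (proj₂ (proj₂ abst))))))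

    negChunk : Fin k → Heap
    negChunk = Vec.lookup (proj₁ negChunks)

    negChunk-neg : ∀ i → NegChunk s h (negChunk i)
    negChunk-neg = proj₁ (proj₂ negChunks)

    negChunk-injective : ∀ i j → negChunk i ≗ʰ negChunk j → i ≡ j
    negChunk-injective = proj₁ (proj₂ (proj₂ negChunks))

    negChunk-complete : ∀ C → NegChunk s h C → Σ (Fin k) λ i → C ≗ʰ negChunk i
    negChunk-complete = proj₂ (proj₂ (proj₂ negChunks))

    edge-sides-agree : ∀ {e e'} (u : InE e) (u' : InE e') → proj₁ e ≐ proj₁ e' → which u ≡ which u'
    edge-sides-agree (inj₁ _) (inj₁ _) _ = refl
    edge-sides-agree (inj₂ _) (inj₂ _) _ = refl
    edge-sides-agree (inj₁ p) (inj₂ p') eq = ⊥-elim (proj₂ compat _ _ (inj₁ (_ , _ , p)) (inj₁ (_ , _ , p')) eq)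
    edge-sides-agree (inj₂ p) (inj₁ p') eq =
      ⊥-elim (proj₂ compat _ _ (inj₁ (_ , _ , p')) (inj₁ (_ , _ , p)) (≐-sym eq))

    block-sides-agree : ∀ {F F' B B'} (u : InR F) (u' : InR F') → F B → F' B' → B ≐ B' → which u ≡ which u'
    block-sides-agree (inj₁ _) (inj₁ _) _ _ _ = refl
    block-sides-agree (inj₂ _) (inj₂ _) _ _ _ = refl
    block-sides-agree {F} {F'} (inj₁ p) (inj₂ p') fb fb' eq =
      ⊥-elim (proj₂ compat _ _ (inj₂ (F , p , fb)) (inj₂ (F' , p' , fb')) eq)
    block-sides-agree {F} {F'} (inj₂ p) (inj₁ p') fb fb' eq =
      ⊥-elim (proj₂ compat _ _ (inj₂ (F' , p' , fb')) (inj₂ (F , p , fb)) (≐-sym eq))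

    Labelled : Heap → Set
    Labelled H = Σ Var λ x → Σ Loc λ l → s x ≡ just l × domH H l

    labelled? : Decidable Labelled
    labelled? H = ∃?-within vars (λ (_ , e , _) → vars-complete e) λ x → ∃-just? (s x) (dom? H)

    labelled-block : ∀ {H} → Labelled H → Σ Block (chunkBlocks s H)
    labelled-block (x , l , e , d) = cl s x , x , ≐-refl , l , e , d

    block-labelled : ∀ {H} → Σ Block (chunkBlocks s H) → Labelled H
    block-labelled (_ , x , _ , l , e , d) = x , l , e , d

    named : Fin k → Bool
    named i = does (labelled? (negChunk i))

    anonymous : Fin k → Bool
    anonymous i = not (named i)

    route : ∀ i → Labelled (negChunk i) → Σ (Block → Set) λ F → InR F × F ≋ chunkBlocks s (negChunk i)
    route i lab = blocks-abstracted _ (negChunk i , negChunk-neg i , ≋-refl , labelled-block {negChunk i} lab)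

    -- A labelled negative chunk goes with its element of R; the anonymous ones are dealt out in order,
    -- the first γ A₁ of them to the left.
    negSide : Fin k → Bool
    negSide i with labelled? (negChunk i)
    ... | yes lab = which (proj₁ (proj₂ (route i lab)))
    ... | no _ = rank anonymous i <ᵇ γ A₁

    negSide-labelled : ∀ i {F} (u : InR F) → F ≋ chunkBlocks s (negChunk i) → Labelled (negChunk i) →
                       negSide i ≡ which u
    negSide-labelled i u F≋ lab′ with labelled? (negChunk i)
    ... | no ¬lab = ⊥-elim (¬lab lab′)
    ... | yes lab =
      let (F″ , u″ , F″≋) = route i lab
          (B , blk) = labelled-block {negChunk i} lab′
          (B₁ , F″B₁ , B₁≐) = proj₂ F″≋ B blk
          (B₂ , FB₂ , B₂≐) = proj₂ F≋ B blk
      in block-sides-agree u″ u F″B₁ FB₂ (≐-trans B₁≐ (≐-sym B₂≐))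

    data View (r : Loc) : Set₁ where
      outside  : ¬ domH h r → View r
      negative : (i : Fin k) → component r ≗ʰ negChunk i → View r
      positive : (seg : IsSegment (component r)) (e : Edge) → InE e → proj₁ e ≐ cl s (proj₁ seg) → View r
      neither  : ¬ (Σ (Fin k) λ i → component r ≗ʰ negChunk i) → ¬ IsSegment (component r) → View r

    positive-view : ∀ {r} → domH h r → IsSegment (component r) → View r
    positive-view {r} dr seg@(_ , _ , _ , _ , 1≤n , sf) =
      let (_ , ce) = segment-edge (component r) 1≤n sf
          pc = component-chunk dr , isSegment⇒atom (component r) seg
          (e , u , e≐) = edge-abstracted _ (chunkEdge⇒Eabs {h} {component r} pc ce)
      in positive seg e u (proj₁ e≐)

    view-inside : ∀ {r} → domH h r → Dec (Σ (Fin k) λ i → component r ≗ʰ negChunk i) →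
                  Dec (IsSegment (component r)) → View r
    view-inside dr (yes (i , eq)) _ = negative i eq
    view-inside dr (no ¬neg) (yes seg) = positive-view dr seg
    view-inside dr (no ¬neg) (no ¬seg) = neither ¬neg ¬seg

    view-at : ∀ {r} → Dec (domH h r) → View r
    view-at {r} (yes dr) = view-inside dr (Fin.any? (λ i → ≗ʰ? (component r) (negChunk i))) (isSegment? (component r))
    view-at (no ¬dr) = outside ¬dr

    view : ∀ r → View r
    view r = view-at (dom? h r)

    viewSide : ∀ {r} → View r → Bool
    viewSide (outside _) = false
    viewSide (negative i _) = negSide i
    viewSide (positive _ _ u _) = which u
    viewSide (neither _ _) = false

    side : Loc → Bool
    side l = viewSide (view (representative l))

    side-connected : ∀ {l m} → domH h l → domH h m → Connected l m → side l ≡ side m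
    side-connected dl dm l~m = cong (viewSide ∘ view) (representative-cong dl dm l~m)

    side-closed : ∀ b → Closed h (λ l → side l ≡ b)
    side-closed b = mkClosed λ dm dm' sm ¬sm' lk →
      ¬sm' (trans (sym (side-connected dm dm' (linked⇒connected dm dm' lk))) sm)

    side-chunk : ∀ {C l l'} → Chunk s h C → domH C l → domH C l' → side l ≡ side l'
    side-chunk {C} {l} {l'} ch (v , e) (v' , e') =
      let C⊆ = subHeap⇒⊆ʰ {C} {h} (proj₁ ch) in
      side-connected (v , C⊆ l v e) (v' , C⊆ l' v' e')
        (restrict-sat h (connected? l) (proj₁ (chunk≗ʰcomponent {C} ch (v , e)) l' v' e'))

    negChunk-side : ∀ i {l} → domH (negChunk i) l → side l ≡ negSide i
    negChunk-side i {l} dl = by-view (view (representative l))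
      where
      ch : Chunk s h (negChunk i)
      ch = proj₁ (negChunk-neg i)
      C : Heap
      C = component (representative l)
      N≗ : negChunk i ≗ʰ C
      N≗ = chunk≗ʰrepresentative {negChunk i} ch dl
      by-view : (v : View (representative l)) → viewSide v ≡ negSide i
      by-view (outside ¬dr) = ⊥-elim (¬dr (representative-in-dom {negChunk i} ch dl))
      by-view (negative j eq) = cong negSide (sym (negChunk-injective i j (≗ʰ-trans {negChunk i} {C} {negChunk j} N≗ eq)))
      by-view (positive seg _ _ _) =
        let (τ , sat) = isSegment⇒atom C seg in
        ⊥-elim (proj₂ (negChunk-neg i) (τ , ⊨-resp-≗ʰ {s} {C} {negChunk i} τ (≗ʰ-sym {negChunk i} {C} N≗) sat))
      by-view (neither ¬neg _) = ⊥-elim (¬neg (i , ≗ʰ-sym {negChunk i} {C} N≗))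

    -- By uniqueness of the labelled start, the edge found for the component has the same source as e.
    posChunk-start-side : ∀ {C e} → PosChunk s h C → (u : InE e) → ∀ {x a n} → proj₁ e ≐ cl s x → s x ≡ just a →
                          1 ≤ n → Walks.Covers C a n → side a ≡ which u
    posChunk-start-side {C} {e} (ch , τ , sat) u {x} {a} {n} src ex 1≤n cov = by-view (view (representative a))
      where
      da : domH C a
      da = proj₁ cov 1≤n
      C≗ : C ≗ʰ component (representative a)
      C≗ = chunk≗ʰrepresentative {C} ch da
      by-view : (v : View (representative a)) → viewSide v ≡ which u
      by-view (outside ¬dr) = ⊥-elim (¬dr (representative-in-dom {C} ch da))
      by-view (negative j eq) =
        ⊥-elim (proj₂ (NegChunk-resp-≗ʰ {h} {negChunk j} {C}
                         (≗ʰ-sym {C} {negChunk j} (≗ʰ-trans {C} {component (representative a)} {negChunk j} C≗ eq))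
                         (negChunk-neg j)) (τ , sat))
      by-view (neither _ ¬seg) =
        ⊥-elim (¬seg (atom⇒isSegment _ (a , proj₁ da , proj₁ C≗ a _ (proj₂ da)) τ (⊨-resp-≗ʰ {s} {C} τ C≗ sat)))
      by-view (positive seg e' u' src') =
        let (a' , ex' , n' , 1≤n' , cov') = isSegment-start _ seg
            a≡a' = chunk-start-unique (component-chunk (representative-in-dom {C} ch da))
                     (Covers-resp-≗ʰ {C} C≗ cov) cov' 1≤n 1≤n' (x , ex) (proj₁ seg , ex')
        in edge-sides-agree u' u (≐-trans src' (≐-trans (cl-≐ ex' (trans ex (cong just a≡a'))) (≐-sym src)))

    posChunk-side : ∀ {C e e'} → PosChunk s h C → ChunkEdge C e' → (u : InE e) → proj₁ e ≐ proj₁ e' →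
                    ∀ {l} → domH C l → side l ≡ which u
    posChunk-side {C} pc ce u e≐ dl =
      let (x , src , a , ex , n , 1≤n , cov) = chunkEdge-start (proj₁ (proj₂ (proj₁ pc))) ce
      in trans (side-chunk {C} (proj₁ pc) dl (proj₁ cov 1≤n)) (posChunk-start-side pc u (≐-trans e≐ src) ex 1≤n cov)

    negChunk-block-side : ∀ {C F} → NegChunk s h C → (u : InR F) → F ≋ chunkBlocks s C → Labelled C →
                          ∀ {l} → domH C l → side l ≡ which u
    negChunk-block-side {C} nc u F≋ (x , a , ex , da) (v , e) =
      let (i , C≗) = negChunk-complete C nc in
      trans (negChunk-side i (v , proj₁ C≗ _ v e))
        (negSide-labelled i u (≋-trans F≋ (chunkBlocks-resp-≗ʰ {s} {C} {negChunk i} C≗))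
          (x , a , ex , proj₁ da , proj₁ C≗ a _ (proj₂ da)))

    named⇒labelled : ∀ {i} → named i ≡ true → Labelled (negChunk i)
    named⇒labelled {i} e with labelled? (negChunk i)
    ... | yes lab = lab

    blocks-injective : ∀ i j → Labelled (negChunk i) → chunkBlocks s (negChunk i) ≋ chunkBlocks s (negChunk j) → i ≡ j
    blocks-injective i j (x , a , ex , da) eq =
      let (B' , (x' , B'≐ , a' , ex' , da') , B≐B') = proj₁ eq (cl s x) (x , ≐-refl , a , ex , da)
          (l , ex″ , exx) = proj₁ (B'≐ x) (proj₁ (B≐B' x) (a , ex , ex))
          a'≡a = just-injective (trans (sym ex') (trans ex″ (trans (sym exx) ex)))
      in negChunk-injective i j
           (≗ʰ-trans {negChunk i} {component a} {negChunk j} (chunk≗ʰcomponent {negChunk i} (proj₁ (negChunk-neg i)) da)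
             (≗ʰ-sym {negChunk j} {component a}
               (chunk≗ʰcomponent {negChunk j} (proj₁ (negChunk-neg j)) (subst (domH (negChunk j)) a'≡a da'))))

    module Enumerate {H} (p : Fin k → Bool) (neg : ∀ {i} → p i ≡ true → NegChunk s H (negChunk i))
                     (classify : ∀ {C} → NegChunk s H C → Σ (Fin k) λ i → p i ≡ true × C ≗ʰ negChunk i) where

      negChunks-size : HasSize _≗ʰ_ (NegChunk s H) (count p)
      negChunks-size = hasSize-count {_≈_ = _≗ʰ_} negChunk p neg (λ {i} {j} _ → negChunk-injective i j) classify

      blocks-size : HasSize _≋_ (Rabs s H) (count (λ i → p i ∧ named i))
      blocks-size = hasSize-count {_≈_ = _≋_} (chunkBlocks s ∘ negChunk) (λ i → p i ∧ named i)
        (λ {i} pn → let (pi , ni) = ∧-true⁻ pn in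
                    negChunk i , neg pi , ≋-refl , labelled-block {negChunk i} (named⇒labelled ni))
        (λ {i} {j} pn → blocks-injective i j (named⇒labelled (proj₂ (∧-true⁻ pn))))
        λ (C , nc , F≋ , blk) →
          let (i , pi , C≗) = classify nc
              (x , a , ex , da) = block-labelled {C} blk
          in i , ∧-true⁺ pi (dec-true (labelled? (negChunk i)) (x , a , ex , proj₁ da , proj₁ C≗ a _ (proj₂ da))) ,
             ≋-trans F≋ (chunkBlocks-resp-≗ʰ {s} {C} {negChunk i} C≗)

    module Half (b : Bool) (A : AMS)
                (E-side : ∀ {e} → E A e → Σ (InE e) λ u → which u ≡ b)
                (side-E : ∀ {e} (u : InE e) → which u ≡ b → E A e)
                (R-side : ∀ {F} → R A F → Σ (InR F) λ u → which u ≡ b)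
                (side-R : ∀ {F} (u : InR F) → which u ≡ b → R A F)
                (V-cls : V A ≋ cls s) (anonymous-count : count (λ i → (negSide i == b) ∧ anonymous i) ≡ γ A) where

      onSide? : Decidable (λ l → side l ≡ b)
      onSide? l = side l Bool.≟ b

      half : Heap
      half = restrict h onSide?

      open Restriction onSide? (side-closed b) using (chunk-restrict⁺; chunk-restrict⁻)

      chunk⊆half : ∀ {C l} → Chunk s h C → domH C l → side l ≡ b → C ⊆ʰ half
      chunk⊆half {C} ch dl sl z v e =
        restrict-keeps h onSide? (trans (side-chunk {C} ch (v , e) dl) sl) (subHeap⇒⊆ʰ {C} {h} (proj₁ ch) z v e)

      ⊆half⇒side : ∀ {C l} → C ⊆ʰ half → domH C l → side l ≡ b
      ⊆half⇒side C⊆ (v , e) = restrict-sat h onSide? (C⊆ _ v e)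

      edges : SetEq _≐E_ (E A) (Eabs s half)
      edges = to , from
        where
        to : ∀ e → E A e → Σ Edge λ e' → Eabs s half e' × e ≐E e'
        to e p =
          let (u , su) = E-side p
              (e' , ea , eq) = edge-realised e u
              (C , pc , ce) = Eabs⇒chunkEdge {h} {e'} ea
              dl = proj₂ (proj₁ (proj₂ (proj₁ pc)))
              C⊆ = chunk⊆half {C} (proj₁ pc) dl (trans (posChunk-side pc ce u (proj₁ eq) dl) su)
          in e' , chunkEdge⇒Eabs {half} {C} {e'} (chunk-restrict⁺ {C} (proj₁ pc) C⊆ , proj₂ pc) ce , eq
        from : ∀ e' → Eabs s half e' → Σ Edge λ e → E A e × e ≐E e'
        from e' ea' =
          let (C , (ch' , atom) , ce) = Eabs⇒chunkEdge {half} {e'} ea'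
              (ch , C⊆) = chunk-restrict⁻ {C} ch'
              (e , u , eq) = edge-abstracted e' (chunkEdge⇒Eabs {h} {C} {e'} (ch , atom) ce)
              dl = proj₂ (proj₁ (proj₂ ch))
          in e , side-E u (trans (sym (posChunk-side (ch , atom) ce u (proj₁ eq) dl)) (⊆half⇒side {C} C⊆ dl)) , eq

      blockSets : SetEq _≋_ (R A) (Rabs s half)
      blockSets = to , from
        where
        to : ∀ F → R A F → Σ (Block → Set) λ F' → Rabs s half F' × F ≋ F'
        to F p =
          let (u , su) = R-side p
              (F' , (C , nc , F'≋ , blk) , F≋F') = blocks-realised F u
              (x , a , ex , da) = block-labelled {C} blk
              C⊆ = chunk⊆half {C} (proj₁ nc) da
                     (trans (negChunk-block-side nc u (≋-trans F≋F' F'≋) (x , a , ex , da) da) su)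
          in F' , (C , (chunk-restrict⁺ {C} (proj₁ nc) C⊆ , proj₂ nc) , F'≋ , blk) , F≋F'
        from : ∀ F' → Rabs s half F' → Σ (Block → Set) λ F → R A F × F ≋ F'
        from F' (C , (ch' , ¬atom) , F'≋ , blk) =
          let (ch , C⊆) = chunk-restrict⁻ {C} ch'
              (F , u , F≋F') = blocks-abstracted F' (C , (ch , ¬atom) , F'≋ , blk)
              (x , a , ex , da) = block-labelled {C} blk
          in F , side-R u (trans (sym (negChunk-block-side (ch , ¬atom) u (≋-trans F≋F' F'≋) (x , a , ex , da) da))
                                 (⊆half⇒side {C} C⊆ da)) , F≋F'

      onSide : Fin k → Bool
      onSide i = negSide i == b

      negChunk-half : ∀ {i} → onSide i ≡ true → NegChunk s half (negChunk i)
      negChunk-half {i} si =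
        let (ch , ¬atom) = negChunk-neg i
            dl = proj₂ (proj₁ (proj₂ ch))
        in chunk-restrict⁺ {negChunk i} ch (chunk⊆half {negChunk i} ch dl (trans (negChunk-side i dl) (==⇒≡ _ b si))) ,
           ¬atom

      classify-half : ∀ {C} → NegChunk s half C → Σ (Fin k) λ i → onSide i ≡ true × C ≗ʰ negChunk i
      classify-half {C} (ch' , ¬atom) =
        let (ch , C⊆) = chunk-restrict⁻ {C} ch'
            (i , C≗) = negChunk-complete C (ch , ¬atom)
            (l , v , e) = proj₁ (proj₂ ch)
        in i , ≡⇒== (trans (sym (negChunk-side i (v , proj₁ C≗ l v e))) (⊆half⇒side {C} C⊆ (v , e))) , C≗

      open Enumerate {half} onSide negChunk-half classify-half

      abst-half : Abst s half A
      abst-half = V-cls , edges , blockSets ,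
        count onSide , count (λ i → onSide i ∧ named i) , negChunks-size , blocks-size ,
        trans (sym anonymous-count)
          (sym (trans (cong (_∸ count (λ i → onSide i ∧ named i)) (count-split onSide named))
                      (m+n∸m≡n (count (λ i → onSide i ∧ named i)) _)))

    classify-all : ∀ {C} → NegChunk s h C → Σ (Fin k) λ i → true ≡ true × C ≗ʰ negChunk i
    classify-all {C} nc = let (i , eq) = negChunk-complete C nc in i , refl , eq

    module AllNegChunks = Enumerate {h} (λ _ → true) (λ {i} _ → negChunk-neg i) classify-all

    anonymous-total : count anonymous ≡ γ A₁ + γ A₂
    anonymous-total = begin
      count anonymous                                         ≡⟨ m+n∸m≡n (count named) _ ⟨
      count named + count anonymous ∸ count named             ≡⟨ cong₂ _∸_ (count-split (λ _ → true) named) r≡ ⟨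
      count {k} (λ _ → true) ∸ r                              ≡⟨ cong (_∸ r) count-true ⟩
      k ∸ r                                                   ≡⟨ γ-sum ⟨
      γ A₁ + γ A₂                                             ∎
      where
      open ≡-Reasoning
      r≡ : r ≡ count named
      r≡ = hasSize-unique ≋-sym ≋-trans blocks AllNegChunks.blocks-size

    left-anonymous : count (λ i → (negSide i == true) ∧ anonymous i) ≡ γ A₁
    left-anonymous = trans (count-cong _ _ pointwise)
      (trans (count-rank< anonymous (γ A₁))
        (m≤n⇒m⊓n≡m (subst (γ A₁ ≤_) (sym anonymous-total) (m≤m+n (γ A₁) (γ A₂)))))
      where
      pointwise : ∀ i → negSide i ∧ anonymous i ≡ anonymous i ∧ (rank anonymous i <ᵇ γ A₁)
      pointwise i with labelled? (negChunk i)
      ... | yes _ = ∧-zeroʳ _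
      ... | no _ = ∧-identityʳ _

    right-anonymous : count (λ i → (negSide i == false) ∧ anonymous i) ≡ γ A₂
    right-anonymous = trans (count-cong _ _ pointwise)
      (trans (count-rank≥ anonymous (γ A₁)) (trans (cong (_∸ γ A₁) anonymous-total) (m+n∸m≡n (γ A₁) (γ A₂))))
      where
      pointwise : ∀ i → not (negSide i) ∧ anonymous i ≡ anonymous i ∧ not (rank anonymous i <ᵇ γ A₁)
      pointwise i with labelled? (negChunk i)
      ... | yes _ = ∧-zeroʳ _
      ... | no _ = ∧-identityʳ _

    module Left = Half true A₁ (λ p → inj₁ p , refl) which-inj₁ (λ p → inj₁ p , refl) which-inj₁
                       (proj₁ abst) left-anonymous
    module Right = Half false A₂ (λ p → inj₂ p , refl) which-inj₂ (λ p → inj₂ p , refl) which-inj₂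
                        (≋-trans (≋-sym (proj₁ compat)) (proj₁ abst)) right-anonymous

    split : Σ Heap λ h₁ → Σ Heap λ h₂ → SepUnion s h h₁ h₂ × Abst s h₁ A₁ × Abst s h₂ A₂
    split = Left.half , Right.half ,
      restrict-sepUnion Left.onSide? Right.onSide? (side-closed true) (λ t f → contradiction (trans (sym t) f) λ ())
        (λ _ → ¬-not) ,
      Left.abst-half , Right.abst-half

mainTheorem13 : (M : Model) (A₁ A₂ : AMS) →
    IsAMS A₁ → IsAMS A₂ →
    Compatible A₁ A₂ → Abst (stk M) (hp M) (A₁ ⊙ A₂) →
    Σ Heap λ h₁ → Σ Heap λ h₂ →
      SepUnion (stk M) (hp M) h₁ h₂ ×
      Abst (stk M) h₁ A₁ × Abst (stk M) h₂ A₂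
mainTheorem13 M A₁ A₂ isAMS₁ _ compat abst =
  WithFiniteStack.Split.split (stk M) vars vars-complete (hp M) A₁ A₂ compat abst
  where
  vars : List Var
  vars = proj₁ (proj₁ (proj₂ (proj₂ isAMS₁)))
  vars-complete : ∀ {x l} → stk M x ≡ just l → x ∈ vars
  vars-complete {x} {l} e =
    let (B , VB , B≐) = proj₂ (proj₁ abst) (cl (stk M) x) (x , (l , e) , ≐-refl)
    in proj₂ (proj₁ (proj₂ (proj₂ isAMS₁))) B x VB (proj₂ (B≐ x) (l , e , e))
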